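{- In type $C_n$, let $J$ be an admissible subset for the $\lambda$-chain $\Gamma$ below, $\sigma=\mathrm{sfill}(J)$ with columns $C_1,\dots,C_{2\lambda_1}$, and $p\in\{0,1,\dots,n\}$. Let $m'$ be the minimal $j\in\{0,\dots,2\lambda_1\}$ with $h_j=\max_t h_t$. If $a_{m'}=\frac12$, then $m'=2i$ for some $1\le i\le\lambda_1$; in this case both $C_{m'-1}$ and $C_{m'}$ contain exactly one element of $\mathcal P^+$, this element is the same for both columns, and neither column contains an element of $\mathcal P^-$.
   Context: Type $C_n$: $V=\mathbb R^n$ with basis $\varepsilon_i$ and standard inner product, roots $\pm\varepsilon_i\pm\varepsilon_j$ ($i<j$) and $\pm2\varepsilon_i$, positive roots $\varepsilon_i\pm\varepsilon_j$ ($i<j$), $2\varepsilon_i$; simple roots $\alpha_i=\varepsilon_i-\varepsilon_{i+1}$ ($1\le i<n$), $\alpha_n=2\varepsilon_n$; $\alpha_0=\theta=-2\varepsilon_1$; $\alpha^\vee=2\alpha/\langle\alpha,\alpha\rangle$; $\rho=(n,n-1,\dots,1)$. $W$ is the group of signed permutations of $[\bar n]=\{1<\dots<n<\bar n<\dots<\bar1\}$ with length $\ell$. Notation: $(i,j)=\varepsilon_i-\varepsilon_j$ with reflection $t_{ij}t_{\bar\jmath\bar\imath}$; $(i,\bar\jmath)=\varepsilon_i+\varepsilon_j$ ($i<j$) with reflection $t_{i\bar\jmath}t_{j\bar\imath}$; $(i,\bar\imath)=2\varepsilon_i$ with reflection $t_{i\bar\imath}$. Quantum Bruhat graph: edges $w\to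 ws_\beta$ ($\beta$ positive) when $\ell(ws_\beta)=\ell(w)+1$ or $\ell(ws_\beta)=\ell(w)-2\langle\rho,\beta^\vee\rangle+1$. For $1\le k\le n$: $\Gamma_i=((i,\overline{i-1}),\dots,(i,\bar1))$; $\Gamma_{ki}=((i,k+1),\dots,(i,n),(i,\bar\imath),(i,\bar n),\dots,(i,\overline{k+1}),(i,\overline{i-1}),\dots,(i,\bar1))$; $\Gamma(k)=\Gamma_{kk}\Gamma_{k,k-1}\cdots\Gamma_{k1}\,\Gamma_k\Gamma_{k-1}\cdots\Gamma_2$, where the part $\Gamma_{kk}\cdots\Gamma_{k1}$ is $\Gamma_l(k)$ and $\Gamma_k\cdots\Gamma_2$ is $\Gamma_r(k)$. With $\lambda$ a partition with at most $n$ parts, $\lambda'$ its conjugate, $\Gamma=(\beta_1,\dots,\beta_m)=\Gamma(\lambda'_1)\cdots\Gamma(\lambda'_{\lambda_1})$, factored into $2\lambda_1$ blocks $\Gamma_l(\lambda'_1),\Gamma_r(\lambda'_1),\Gamma_l(\lambda'_2),\dots$. Let $r_i=s_{\beta_i}$. $J=\{j_1<\dots<j_s\}\subseteq[m]$ is admissible if $1\to r_{j_1}\to r_{j_1}r_{j_2}\to\cdots\to r_{j_1}\cdots r_{j_s}$ is a path in the quantum Bruhat graph. For $J$, $T^q$ is the sequence of $\beta_j$, $j\in J$, in block $q$, $\pi_q$ the left-to-right product of the reflections in $T^1,\dots,T^q$, $C_q$ the column $\pi_q(1),\dots,\pi_q(\lambda'_{\lceil q/2\rceil})$ sorted increasingly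 in $[\bar n]$, $\mathrm{sfill}(J)=C_1\cdots C_{2\lambda_1}$. For a filling $\tau$, $N_c(\tau)$ is the number of entries $c$, and $\mathrm{ct}(\tau)=(c_1,\dots,c_n)$ with $c_i=\frac12(N_i(\tau)-N_{\bar\imath}(\tau))$. Set $a_0=0$, $a_i=\langle\mathrm{ct}(C_i),\alpha_p^\vee\rangle$, $h_j=\sum_{i=0}^ja_i$. Sets: for $1\le p\le n-1$, $\mathcal P^+=\{p,\overline{p+1}\}$, $\mathcal P^-=\{p+1,\bar p\}$; for $p=n$, $\mathcal P^+=\{n\}$, $\mathcal P^-=\{\bar n\}$; for $p=0$, $\mathcal P^+=\{\bar1\}$, $\mathcal P^-=\{1\}$. (It is known that for admissible $J$ each pair $(C_{2q-1},C_{2q})$ is the split column $(lK,rK)$ of a Kashiwara–Nakashima column $K$, in the sense: if $z_1>\dots>z_k$ are the $z\in[n]$ with $z,\bar z\in K$, and $t_1$ is the largest element of $[n]$ with $t_1<z_1$, $t_1,\bar t_1\notin K$, $t_i$ the largest with $t_i<\min(t_{i-1},z_i)$, $t_i,\bar t_i\notin K$, then $lK$ replaces each $z_i$ by $t_i$ and $rK$ replaces each $\bar z_i$ by $\bar t_i$, followed by sorting.) -}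

module Defs where

open import Data.Nat using (ℕ; zero; suc; _+_; _*_; _∸_; _≤ᵇ_; _<ᵇ_; _≡ᵇ_)
open import Data.Nat.Properties using (≤-decTotalOrder)
open import Data.Bool using (Bool; true; false; if_then_else_; _∧_)
open import Data.List using (List; []; _∷_; _++_; map; concat; length; upTo; reverse; take; drop; zip; foldl)
open import Data.Nat.ListAction using (sum)
open import Data.List.Sort ≤-decTotalOrder using (sort)
import Data.Integer as ℤ
open ℤ using (ℤ)
open import Data.Product using (_×_; _,_)
open import Data.Sum using (_⊎_)
open import Data.Unit using (⊤)
open import Data.Vec using (toList)
open import Data.Fin.Subset using (Subset)
open import Relation.Binary.PropositionalEquality using (_≡_)

part₁ : List ℕ → ℕ
part₁ []      = 0
part₁ (x ∷ _) = x

countGe : ℕ → List ℕ → ℕ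
countGe j xs = sum (map (λ x → if j ≤ᵇ x then 1 else 0) xs)

-- inclusive ascending range a, a+1, ..., b  (empty if a > b)
asc : ℕ → ℕ → List ℕ
asc a b = map (λ k → a + k) (upTo (suc b ∸ a))

desc : ℕ → ℕ → List ℕ
desc a b = reverse (asc b a)

conj : List ℕ → List ℕ
conj lam = map (λ j → countGe j lam) (asc 1 (part₁ lam))

-- Type C_n.  The alphabet [n̄] = {1 < ... < n < n̄ < ... < 1̄} is encoded
-- by natural numbers 1, ..., 2n with  i ↦ i  and  ī ↦ 2n+1-i, so that the
-- order of [n̄] is the usual order of ℕ.

module TypeC (n : ℕ) where

  bar : ℕ → ℕ
  bar c = suc (2 * n) ∸ c

  letters : List ℕ
  letters = asc 1 (2 * n)

  -- a root written as a pair (a , b) of letters stands for ε_a - ε_b,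
  -- where ε_ī = - ε_i.  So (i , j) = ε_i - ε_j, (i , j̄) = ε_i + ε_j,
  -- (i , ī) = 2 ε_i, as in the paper.
  Root : Set
  Root = ℕ × ℕ

  -- Weyl group elements: signed permutations of [n̄], as functions on codes
  Weyl : Set
  Weyl = ℕ → ℕ

  swap : ℕ → ℕ → Weyl
  swap a b x = if x ≡ᵇ a then b else (if x ≡ᵇ b then a else x)

  -- reflection s_β:  t_{ab} t_{b̄ ā}  for short roots,  t_{a ā} for long roots
  sRefl : Root → Weyl
  sRefl (a , b) = if b ≡ᵇ bar a then swap a b else (λ x → swap a b (swap (bar a) (bar b) x))

  -- ε_x - ε_y is a positive root iff x < y; positive roots are the pairs
  -- (a , b) with a < b and a ≤ b̄ (each positive root exactly once).
  -- Length ℓ(w) = #{ β ∈ Φ⁺ : w(β) ∈ Φ⁻ }.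
  len : Weyl → ℕ
  len w = sum (map (λ a → sum (map (λ b →
            if (a <ᵇ b) ∧ (a + b ≤ᵇ suc (2 * n)) ∧ (w b <ᵇ w a) then 1 else 0)
            letters)) letters)

  -- ρ = (n, n-1, ..., 1):  ⟨ρ, ε_x⟩
  ρ : ℕ → ℤ
  ρ c = if c ≤ᵇ n then ℤ.+ suc n ℤ.- ℤ.+ c else ℤ.+ n ℤ.- ℤ.+ c

  ρcoroot : Root → ℤ
  ρcoroot (a , b) = if b ≡ᵇ bar a then ρ a else ρ a ℤ.- ρ b

  QBGEdge : Weyl → Root → Set
  QBGEdge w β =
    (len (λ x → w (sRefl β x)) ≡ suc (len w)) ⊎
    (ℤ.+ len (λ x → w (sRefl β x)) ≡ ℤ.+ len w ℤ.- ℤ.+ 2 ℤ.* ρcoroot β ℤ.+ ℤ.+ 1)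

  Γi : ℕ → List Root
  Γi i = map (λ j → (i , bar j)) (desc (i ∸ 1) 1)

  Γki : ℕ → ℕ → List Root
  Γki k i = map (λ j → (i , j)) (asc (suc k) n)
         ++ (i , bar i)
          ∷ map (λ j → (i , bar j)) (desc n (suc k))
         ++ map (λ j → (i , bar j)) (desc (i ∸ 1) 1)

  Γl : ℕ → List Root
  Γl k = concat (map (Γki k) (desc k 1))

  Γr : ℕ → List Root
  Γr k = concat (map Γi (desc k 2))

  blocks : List ℕ → List (List Root)
  blocks lam = concat (map (λ c → Γl c ∷ Γr c ∷ []) (conj lam))

  -- number of entries of the column belonging to each block
  blockSizes : List ℕ → List ℕ
  blockSizes lam = concat (map (λ c → c ∷ c ∷ []) (conj lam))

  Γ : List ℕ → List Root
  Γ lam = concat (blocks lam)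

  -- J ⊆ [m] as a characteristic vector; the roots β_j, j ∈ J, in order
  selected : List (Root × Bool) → List Root
  selected []                 = []
  selected ((β , true) ∷ xs)  = β ∷ selected xs
  selected ((β , false) ∷ xs) = selected xs

  marked : (lam : List ℕ) → Subset (length (Γ lam)) → List (Root × Bool)
  marked lam J = zip (Γ lam) (toList J)

  Path : Weyl → List Root → Set
  Path w []       = ⊤
  Path w (β ∷ βs) = QBGEdge w β × Path (λ x → w (sRefl β x)) βs

  Admissible : (lam : List ℕ) → Subset (length (Γ lam)) → Set
  Admissible lam J = Path (λ x → x) (selected (marked lam J))

  chunks : {A : Set} → List ℕ → List A → List (List A)
  chunks []       xs = []
  chunks (k ∷ ks) xs = take k xs ∷ chunks ks (drop k xs)

  mult : Weyl → List Root → Weyl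
  mult = foldl (λ w β x → w (sRefl β x))

  colsGo : Weyl → List ℕ → List (List Root) → List (List ℕ)
  colsGo w (c ∷ cs) (T ∷ Ts) = sort (map (mult w T) (asc 1 c)) ∷ colsGo (mult w T) cs Ts
  colsGo w _        _        = []

  sfill : (lam : List ℕ) → Subset (length (Γ lam)) → List (List ℕ)
  sfill lam J = colsGo (λ x → x) (blockSizes lam)
                  (map selected (chunks (map length (blocks lam)) (marked lam J)))

  -- q-th element (1-based) of a list of columns
  colAt : List (List ℕ) → ℕ → List ℕ
  colAt []       _             = []
  colAt (C ∷ Cs) zero          = []
  colAt (C ∷ Cs) (suc zero)    = C
  colAt (C ∷ Cs) (suc (suc q)) = colAt Cs (suc q)

  col : (lam : List ℕ) → Subset (length (Γ lam)) → ℕ → List ℕ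
  col lam J q = colAt (sfill lam J) q

  N : ℕ → List ℕ → ℕ
  N c τ = sum (map (λ x → if x ≡ᵇ c then 1 else 0) τ)

  -- 2 c_i  where ct(τ) = (c_1, ..., c_n)
  ct2 : List ℕ → ℕ → ℤ
  ct2 τ i = ℤ.+ N i τ ℤ.- ℤ.+ N (bar i) τ

  -- 2 ⟨ct(τ), α_p^∨⟩
  pair2 : ℕ → List ℕ → ℤ
  pair2 zero    τ = ℤ.- ct2 τ 1
  pair2 (suc k) τ = if suc k ≡ᵇ n then ct2 τ n else ct2 τ (suc k) ℤ.- ct2 τ (suc (suc k))

  -- 2 a_j  (a_0 = 0)
  a2 : (lam : List ℕ) → Subset (length (Γ lam)) → ℕ → ℕ → ℤ
  a2 lam J p zero    = ℤ.+ 0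
  a2 lam J p (suc j) = pair2 p (col lam J (suc j))

  -- 2 h_j = Σ_{i=0}^{j} 2 a_i
  h2 : (lam : List ℕ) → Subset (length (Γ lam)) → ℕ → ℕ → ℤ
  h2 lam J p zero    = ℤ.+ 0
  h2 lam J p (suc j) = h2 lam J p j ℤ.+ a2 lam J p (suc j)

  Pplus : ℕ → List ℕ
  Pplus zero    = bar 1 ∷ []
  Pplus (suc k) = if suc k ≡ᵇ n then n ∷ [] else suc k ∷ bar (suc (suc k)) ∷ []

  Pminus : ℕ → List ℕ
  Pminus zero    = 1 ∷ []
  Pminus (suc k) = if suc k ≡ᵇ n then bar n ∷ [] else suc (suc k) ∷ bar (suc k) ∷ []

-- The columns C_{2i-1}, C_{2i} of sfill(J) are the sorted sets w[1..c] and w′[1..c], where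
-- w′ = w r_{j₁} ⋯ r_{jₖ} runs over the admissible roots of the block Γ_r(c), all of the form
-- ε_a + ε_b with a < b ≤ c.  Counting inversions pair by pair, the length change of such a
-- reflection along an ascent lies between 1 and 1 + 2(n−a) + 2(n−b); this rules out quantum
-- steps and descents, so every step is a Bruhat cover: w(a) and w(b) have opposite signs and no
-- w(q), q > b, lies between w(a) and w(b)‾.  Such a step keeps the classes {z, z̄} meeting the
-- column, and when exactly one of the two classes relevant to α_p meets it, it keeps the letters
-- of P⁺ and adds none of P⁻.  Recording the letters of P^± in C and D as Booleans, a finite
-- truth table then shows that a_{2i-1} = ½ forces a_{2i} > 0, so the first maximum of h is not
-- at an odd index, and that a_{2i} = ½ with h_{2i} > h_{2i-2} forces the stated pattern.

module Submission where

open import Defs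
open import Data.Nat using (ℕ; _≤_; _<_; _*_)
open import Data.Integer as ℤ using (+_)
open import Data.List using (List; length)
open import Data.List.Membership.Propositional using (_∈_; _∉_)
open import Data.List.Relation.Unary.Linked using (Linked)
open import Data.Nat using (_≥_)
open import Data.Fin.Subset using (Subset)
open import Data.Product using (_×_; ∃)
open import Relation.Binary.PropositionalEquality using (_≡_)

open import Data.Nat using (zero; suc; _+_; _∸_; _≤ᵇ_; _<ᵇ_; _≡ᵇ_; z≤n; s≤s; _≤?_)
open import Data.Nat.Properties
import Data.Integer as Z
open Z using (ℤ; 0ℤ; 1ℤ) renaming (_+_ to _+ᶻ_; _-_ to _-ᶻ_; _*_ to _*ᶻ_; -_ to -ᶻ_; _≤_ to _≤ᶻ_)
import Data.Integer.Properties as ZP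
open import Data.Integer.Tactic.RingSolver using (solve-∀)
open import Data.Bool using (Bool; true; false; T; if_then_else_; _∧_; _∨_; not; _xor_)
open import Data.List using ([]; _∷_; _++_; map; concat; zip; take; drop; applyUpTo)
import Data.List.Properties as LP
open import Data.List.Membership.Propositional.Properties using (∈-map⁻; ∈-++⁻; ∈-concat⁻′)
open import Data.List.Relation.Unary.Any using (here; there)
open import Data.List.Relation.Unary.Any.Properties using (reverse⁻)
open import Data.List.Relation.Unary.All using (All; []; _∷_; tabulate)
open import Data.List.Relation.Binary.Permutation.Propositional.Properties using (map⁺)
open import Data.List.Sort ≤-decTotalOrder using (sort; sort-↭)
open import Data.Nat.ListAction using (sum)
open import Data.Nat.ListAction.Properties using (sum-↭)
open import Data.Vec using (toList)
open import Data.Product using (_,_; proj₁; proj₂; Σ-syntax)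
open import Data.Sum using (_⊎_; inj₁; inj₂)
open import Data.Empty using (⊥; ⊥-elim)
open import Data.Unit using (tt)
open import Relation.Binary using (tri<; tri≈; tri>)
open import Relation.Binary.PropositionalEquality using (_≢_; ≢-sym; refl; sym; trans; cong; cong₂; subst; subst₂; module ≡-Reasoning)
open import Relation.Nullary using (¬_; yes; no)

≡ᵇ-refl : ∀ x → (x ≡ᵇ x) ≡ true
≡ᵇ-refl zero = refl
≡ᵇ-refl (suc x) = ≡ᵇ-refl x

≡ᵇ⇒ : ∀ {x y} → (x ≡ᵇ y) ≡ true → x ≡ y
≡ᵇ⇒ {x} {y} e = ≡ᵇ⇒≡ x y (subst T (sym e) tt)

≢⇒≡ᵇf : ∀ {x y} → x ≢ y → (x ≡ᵇ y) ≡ false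
≢⇒≡ᵇf {x} {y} ne with x ≡ᵇ y in e
... | true = ⊥-elim (ne (≡ᵇ⇒ e))
... | false = refl

≡ᵇf⇒≢ : ∀ {x y} → (x ≡ᵇ y) ≡ false → x ≢ y
≡ᵇf⇒≢ {x} e refl with () ← trans (sym (≡ᵇ-refl x)) e

<⇒<ᵇt : ∀ {x y} → x < y → (x <ᵇ y) ≡ true
<⇒<ᵇt {x} {y} lt with x <ᵇ y in e
... | true = refl
... | false = ⊥-elim (subst T e (<⇒<ᵇ lt))

≮⇒<ᵇf : ∀ {x y} → ¬ (x < y) → (x <ᵇ y) ≡ false
≮⇒<ᵇf {x} {y} nlt with x <ᵇ y in e
... | true = ⊥-elim (nlt (<ᵇ⇒< x y (subst T (sym e) tt)))
... | false = refl

≤⇒<ᵇf : ∀ {x y} → y ≤ x → (x <ᵇ y) ≡ false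
≤⇒<ᵇf h = ≮⇒<ᵇf (≤⇒≯ h)

<ᵇt⇒< : ∀ {x y} → (x <ᵇ y) ≡ true → x < y
<ᵇt⇒< {x} {y} e = <ᵇ⇒< x y (subst T (sym e) tt)

<ᵇf⇒≥ : ∀ {x y} → (x <ᵇ y) ≡ false → y ≤ x
<ᵇf⇒≥ {x} {y} e = ≮⇒≥ (λ lt → subst T e (<⇒<ᵇ lt))

≤⇒≤ᵇt : ∀ {x y} → x ≤ y → (x ≤ᵇ y) ≡ true
≤⇒≤ᵇt {x} {y} lt with x ≤ᵇ y in e
... | true = refl
... | false = ⊥-elim (subst T e (≤⇒≤ᵇ lt))

≰⇒≤ᵇf : ∀ {x y} → ¬ (x ≤ y) → (x ≤ᵇ y) ≡ false
≰⇒≤ᵇf {x} {y} nlt with x ≤ᵇ y in e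
... | true = ⊥-elim (nlt (≤ᵇ⇒≤ x y (subst T (sym e) tt)))
... | false = refl

<ᵇ-flip : ∀ {x y} → x ≢ y → (x <ᵇ y) ≡ not (y <ᵇ x)
<ᵇ-flip {x} {y} ne with <-cmp x y
... | tri< lt _ _ rewrite <⇒<ᵇt lt | ≤⇒<ᵇf (<⇒≤ lt) = refl
... | tri≈ _ e _ = ⊥-elim (ne e)
... | tri> _ _ gt rewrite <⇒<ᵇt gt | ≤⇒<ᵇf (<⇒≤ gt) = refl

≤ᵇ≡<ᵇ : ∀ {x y} → x ≢ y → (x ≤ᵇ y) ≡ (x <ᵇ y)
≤ᵇ≡<ᵇ {x} {y} ne with x <ᵇ y in e
... | true = ≤⇒≤ᵇt (<⇒≤ (<ᵇt⇒< {x} {y} e))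
... | false = ≰⇒≤ᵇf (λ h → ne (≤-antisym h (<ᵇf⇒≥ {x} {y} e)))

x+x≢1+y+y : ∀ x y → x + x ≢ suc (y + y)
x+x≢1+y+y zero y ()
x+x≢1+y+y (suc x) zero h rewrite +-suc x x with () ← suc-injective h
x+x≢1+y+y (suc x) (suc y) h rewrite +-suc x x | +-suc y y = x+x≢1+y+y x y (suc-injective (suc-injective h))

countGe≤length : ∀ j (xs : List ℕ) → countGe j xs ≤ length xs
countGe≤length j [] = z≤n
countGe≤length j (x ∷ xs) with j ≤ᵇ x
... | true = s≤s (countGe≤length j xs)
... | false = ≤-trans (countGe≤length j xs) (n≤1+n _)

2*[1+i]≡2+2*i : ∀ i → 2 * suc i ≡ suc (suc (2 * i))
2*[1+i]≡2+2*i i = cong suc (+-suc i (i + 0))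

even⊎odd : ∀ j → (Σ[ i ∈ ℕ ] j ≡ 2 * i) ⊎ (Σ[ i ∈ ℕ ] j ≡ suc (2 * i))
even⊎odd zero = inj₁ (0 , refl)
even⊎odd (suc j) with even⊎odd j
... | inj₁ (i , e) = inj₂ (i , cong suc e)
... | inj₂ (i , e) = inj₁ (suc i , trans (cong suc e) (sym (2*[1+i]≡2+2*i i)))

+[m∸k]≡+m-+k : ∀ {m k} → k ≤ m → + (m ∸ k) ≡ + m -ᶻ + k
+[m∸k]≡+m-+k {m} {k} h = trans (sym (ZP.⊖-≥ h)) (sym (ZP.m-n≡m⊖n m k))

x+y≤x⇒y≤0 : ∀ x y → x +ᶻ y ≤ᶻ x → y ≤ᶻ 0ℤ
x+y≤x⇒y≤0 x y h = subst₂ _≤ᶻ_ (cancel x y) (ZP.+-inverseʳ x) (ZP.+-monoˡ-≤ (-ᶻ x) h)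
  where
    cancel : ∀ x y → x +ᶻ y +ᶻ -ᶻ x ≡ y
    cancel = solve-∀

≤-+-nonneg : ∀ {i j} → 0ℤ ≤ᶻ j → i ≤ᶻ i +ᶻ j
≤-+-nonneg {i} {j} h = ZP.≤-trans (ZP.≤-reflexive (sym (ZP.+-identityʳ i))) (ZP.+-monoʳ-≤ i h)

module _ {A B : Set} where

  zip-++ : ∀ (xs ys : List A) (bs : List B) → zip (xs ++ ys) bs ≡ zip xs (take (length xs) bs) ++ zip ys (drop (length xs) bs)
  zip-++ [] ys bs = refl
  zip-++ (x ∷ xs) ys [] = sym (LP.zipWith-zeroʳ _,_ ys)
  zip-++ (x ∷ xs) ys (b ∷ bs) = cong ((x , b) ∷_) (zip-++ xs ys bs)

  take-zip-++ : ∀ (xs ys : List A) (bs : List B) → take (length xs) (zip (xs ++ ys) bs) ≡ zip xs (take (length xs) bs)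
  take-zip-++ [] ys bs = refl
  take-zip-++ (x ∷ xs) ys [] = refl
  take-zip-++ (x ∷ xs) ys (b ∷ bs) = cong ((x , b) ∷_) (take-zip-++ xs ys bs)

  drop-zip-++ : ∀ (xs ys : List A) (bs : List B) → drop (length xs) (zip (xs ++ ys) bs) ≡ zip ys (drop (length xs) bs)
  drop-zip-++ [] ys bs = refl
  drop-zip-++ (x ∷ xs) ys [] = sym (LP.zipWith-zeroʳ _,_ ys)
  drop-zip-++ (x ∷ xs) ys (b ∷ bs) = drop-zip-++ xs ys bs

  zipChunks : List (List A) → List B → List (List (A × B))
  zipChunks [] bs = []
  zipChunks (xs ∷ xss) bs = zip xs (take (length xs) bs) ∷ zipChunks xss (drop (length xs) bs)

∑ : List ℕ → (ℕ → ℤ) → ℤ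
∑ [] f = 0ℤ
∑ (x ∷ xs) f = f x +ᶻ ∑ xs f

when : Bool → ℤ → ℤ
when true z = z
when false z = 0ℤ

when-distrib-+ : ∀ b x y → when b (x +ᶻ y) ≡ when b x +ᶻ when b y
when-distrib-+ true x y = refl
when-distrib-+ false x y = refl

∑-cong : ∀ xs {f g} → (∀ x → x ∈ xs → f x ≡ g x) → ∑ xs f ≡ ∑ xs g
∑-cong [] h = refl
∑-cong (x ∷ xs) h = cong₂ _+ᶻ_ (h x (here refl)) (∑-cong xs (λ y m → h y (there m)))

∑-distrib-+ : ∀ xs f g → ∑ xs (λ x → f x +ᶻ g x) ≡ ∑ xs f +ᶻ ∑ xs g
∑-distrib-+ [] f g = refl
∑-distrib-+ (x ∷ xs) f g rewrite ∑-distrib-+ xs f g = shuffle (f x) (g x) (∑ xs f) (∑ xs g)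
  where
    shuffle : ∀ a b c d → a +ᶻ b +ᶻ (c +ᶻ d) ≡ a +ᶻ c +ᶻ (b +ᶻ d)
    shuffle = solve-∀

∑-distrib-neg : ∀ xs f → ∑ xs (λ x → -ᶻ f x) ≡ -ᶻ ∑ xs f
∑-distrib-neg [] f = refl
∑-distrib-neg (x ∷ xs) f rewrite ∑-distrib-neg xs f = sym (ZP.neg-distrib-+ (f x) (∑ xs f))

∑-distrib-- : ∀ xs f g → ∑ xs (λ x → f x -ᶻ g x) ≡ ∑ xs f -ᶻ ∑ xs g
∑-distrib-- xs f g = trans (∑-distrib-+ xs f (λ x → -ᶻ g x)) (cong (∑ xs f +ᶻ_) (∑-distrib-neg xs g))

∑-distrib-++ : ∀ xs ys f → ∑ (xs ++ ys) f ≡ ∑ xs f +ᶻ ∑ ys f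
∑-distrib-++ [] ys f = sym (ZP.+-identityˡ _)
∑-distrib-++ (x ∷ xs) ys f rewrite ∑-distrib-++ xs ys f = sym (ZP.+-assoc (f x) _ _)

∑-zero : ∀ xs {f} → (∀ x → x ∈ xs → f x ≡ 0ℤ) → ∑ xs f ≡ 0ℤ
∑-zero [] h = refl
∑-zero (x ∷ xs) h rewrite h x (here refl) | ∑-zero xs (λ y m → h y (there m)) = refl

∑-when : ∀ xs b (f : ℕ → ℤ) → ∑ xs (λ x → when b (f x)) ≡ when b (∑ xs f)
∑-when xs true f = refl
∑-when xs false f = ∑-zero xs (λ _ _ → refl)

∑-const-1 : ∀ xs → ∑ xs (λ _ → 1ℤ) ≡ + length xs
∑-const-1 [] = refl
∑-const-1 (x ∷ xs) rewrite ∑-const-1 xs = refl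

∑-mono-≤ : ∀ xs {f g : ℕ → ℤ} → (∀ x → x ∈ xs → f x ≤ᶻ g x) → ∑ xs f ≤ᶻ ∑ xs g
∑-mono-≤ [] h = ZP.≤-refl
∑-mono-≤ (x ∷ xs) h = ZP.+-mono-≤ (h x (here refl)) (∑-mono-≤ xs (λ y m → h y (there m)))

∑-nonneg : ∀ xs {f : ℕ → ℤ} → (∀ x → x ∈ xs → 0ℤ ≤ᶻ f x) → 0ℤ ≤ᶻ ∑ xs f
∑-nonneg [] h = ZP.≤-refl
∑-nonneg (x ∷ xs) h = ZP.≤-trans (h x (here refl)) (≤-+-nonneg (∑-nonneg xs (λ y m → h y (there m))))

term≤∑-nonneg : ∀ xs {f : ℕ → ℤ} {x₀} → x₀ ∈ xs → (∀ x → x ∈ xs → 0ℤ ≤ᶻ f x) → f x₀ ≤ᶻ ∑ xs f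
term≤∑-nonneg (x ∷ xs) (here refl) h = ≤-+-nonneg (∑-nonneg xs (λ y m → h y (there m)))
term≤∑-nonneg (x ∷ xs) {f} (there m) h = ZP.≤-trans (term≤∑-nonneg xs m (λ y m → h y (there m)))
  (ZP.≤-trans (ZP.≤-reflexive (sym (ZP.+-identityˡ _))) (ZP.+-monoˡ-≤ (∑ xs f) (h x (here refl))))

range : ℕ → ℕ → List ℕ
range s zero = []
range s (suc k) = s ∷ range (suc s) k

length-range : ∀ s k → length (range s k) ≡ k
length-range s zero = refl
length-range s (suc k) = cong suc (length-range (suc s) k)

applyUpTo≡range : ∀ k s (g : ℕ → ℕ) → (∀ i → g i ≡ s + i) → applyUpTo g k ≡ range s k
applyUpTo≡range zero s g h = refl
applyUpTo≡range (suc k) s g h = cong₂ _∷_ (trans (h 0) (+-identityʳ s))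
  (applyUpTo≡range k (suc s) (λ i → g (suc i)) (λ i → trans (h (suc i)) (+-suc s i)))

asc≡range : ∀ a b → asc a b ≡ range a (suc b ∸ a)
asc≡range a b = trans (LP.map-applyUpTo (λ i → i) (λ k → a + k) (suc b ∸ a)) (applyUpTo≡range _ a _ (λ i → refl))

∈-range⁻ : ∀ {x s k} → x ∈ range s k → s ≤ x × x < s + k
∈-range⁻ {x} {s} {suc k} (here refl) = ≤-refl , subst (x <_) (sym (+-suc x k)) (s≤s (m≤m+n x k))
∈-range⁻ {x} {s} {suc k} (there m) with ∈-range⁻ {x} {suc s} {k} m
... | h1 , h2 = <⇒≤ h1 , subst (x <_) (sym (+-suc s k)) h2

∈-range⁺ : ∀ {x s k} → s ≤ x → x < s + k → x ∈ range s k
∈-range⁺ {x} {s} {zero} h1 h2 = ⊥-elim (<⇒≱ h2 (≤-trans (≤-reflexive (+-identityʳ s)) h1))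
∈-range⁺ {x} {s} {suc k} h1 h2 with x ≟ s
... | yes refl = here refl
... | no ne = there (∈-range⁺ (≤∧≢⇒< h1 (λ e → ne (sym e))) (subst (x <_) (+-suc s k) h2))

range-++ : ∀ s k l → range s (k + l) ≡ range s k ++ range (s + k) l
range-++ s zero l = cong (λ z → range z l) (sym (+-identityʳ s))
range-++ s (suc k) l = cong (s ∷_) (trans (range-++ (suc s) k l) (cong (λ z → range (suc s) k ++ range z l) (sym (+-suc s k))))

range-snoc : ∀ t k → range t (suc k) ≡ range t k ++ (t + k ∷ [])
range-snoc t k = trans (cong (range t) (+-comm 1 k)) (range-++ t k 1)

∑-range-reflect : ∀ (f : ℕ → ℤ) k s t c → s + t + k ≡ suc c → ∑ (range s k) f ≡ ∑ (range t k) (λ x → f (c ∸ x))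
∑-range-reflect f zero s t c e = refl
∑-range-reflect f (suc k) s t c e = begin
    f s +ᶻ ∑ (range (suc s) k) f ≡⟨ cong (f s +ᶻ_) (∑-range-reflect f k (suc s) t c e′) ⟩
    f s +ᶻ ∑ (range t k) g ≡⟨ ZP.+-comm (f s) _ ⟩
    ∑ (range t k) g +ᶻ f s ≡⟨ cong (∑ (range t k) g +ᶻ_) (trans (cong f (sym c∸[t+k]≡s)) (sym (ZP.+-identityʳ _))) ⟩
    ∑ (range t k) g +ᶻ ∑ (t + k ∷ []) g ≡⟨ sym (∑-distrib-++ (range t k) (t + k ∷ []) g) ⟩
    ∑ (range t k ++ (t + k ∷ [])) g ≡⟨ cong (λ z → ∑ z g) (sym (range-snoc t k)) ⟩
    ∑ (range t (suc k)) g ∎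
  where
    open ≡-Reasoning
    g = λ x → f (c ∸ x)
    e′ : suc s + t + k ≡ suc c
    e′ = trans (cong suc (+-assoc s t k)) (trans (sym (+-suc s (t + k))) (trans (cong (λ z → s + z) (sym (+-suc t k))) (trans (sym (+-assoc s t (suc k))) e)))
    c∸[t+k]≡s : c ∸ (t + k) ≡ s
    c∸[t+k]≡s = begin
      c ∸ (t + k) ≡⟨ cong (_∸ (t + k)) (suc-injective (trans (sym e) (trans (+-assoc s t (suc k)) (trans (cong (λ z → s + z) (+-suc t k)) (+-suc s (t + k)))))) ⟩
      s + (t + k) ∸ (t + k) ≡⟨ m+n∸n≡m s (t + k) ⟩
      s ∎

∑-range-point : ∀ k s y (g : ℕ → ℤ) → s ≤ y → y < s + k → ∑ (range s k) (λ x → when (x ≡ᵇ y) (g x)) ≡ g y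
∑-range-point zero s y g h1 h2 = ⊥-elim (<⇒≱ h2 (≤-trans (≤-reflexive (+-identityʳ s)) h1))
∑-range-point (suc k) s y g h1 h2 with s ≟ y
... | yes refl rewrite ≡ᵇ-refl s = trans (cong (g s +ᶻ_) (∑-zero (range (suc s) k) rest)) (ZP.+-identityʳ _)
  where
    rest : ∀ x → x ∈ range (suc s) k → when (x ≡ᵇ s) (g x) ≡ 0ℤ
    rest x m rewrite ≢⇒≡ᵇf {x} {s} (λ e → <-irrefl (sym e) (proj₁ (∈-range⁻ m))) = refl
... | no ne rewrite ≢⇒≡ᵇf ne = trans (ZP.+-identityˡ _) (∑-range-point k (suc s) y g (≤∧≢⇒< h1 ne) (subst (y <_) (+-suc s k) h2))

∑-count-> : ∀ a m → a ≤ m → ∑ (range 1 m) (λ q → when (a <ᵇ q) 1ℤ) ≡ + (m ∸ a)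
∑-count-> a m a≤m = begin
    ∑ (range 1 m) f ≡⟨ cong (λ z → ∑ (range 1 z) f) (sym (m+[n∸m]≡n a≤m)) ⟩
    ∑ (range 1 (a + (m ∸ a))) f ≡⟨ cong (λ z → ∑ z f) (range-++ 1 a (m ∸ a)) ⟩
    ∑ (range 1 a ++ range (suc a) (m ∸ a)) f ≡⟨ ∑-distrib-++ (range 1 a) _ f ⟩
    ∑ (range 1 a) f +ᶻ ∑ (range (suc a) (m ∸ a)) f ≡⟨ cong₂ _+ᶻ_ (∑-zero (range 1 a) below) (∑-cong (range (suc a) (m ∸ a)) above) ⟩
    0ℤ +ᶻ ∑ (range (suc a) (m ∸ a)) (λ _ → 1ℤ) ≡⟨ ZP.+-identityˡ _ ⟩
    ∑ (range (suc a) (m ∸ a)) (λ _ → 1ℤ) ≡⟨ ∑-const-1 (range (suc a) (m ∸ a)) ⟩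
    + length (range (suc a) (m ∸ a)) ≡⟨ cong +_ (length-range _ _) ⟩
    + (m ∸ a) ∎
  where
    open ≡-Reasoning
    f = λ q → when (a <ᵇ q) 1ℤ
    below : ∀ x → x ∈ range 1 a → f x ≡ 0ℤ
    below x mm rewrite ≤⇒<ᵇf {a} {x} (≤-pred (proj₂ (∈-range⁻ mm))) = refl
    above : ∀ x → x ∈ range (suc a) (m ∸ a) → f x ≡ 1ℤ
    above x mm rewrite <⇒<ᵇt {a} {x} (proj₁ (∈-range⁻ mm)) = refl

-- Splitting a double sum along four marked indices

module FourPointSplit (L : List ℕ) (D : ℕ → ℕ → ℤ) (marked : ℕ → Bool) (m₁ m₂ m₃ m₄ : ℕ)
  (unmarked-vanish : ∀ c d → c ∈ L → d ∈ L → marked c ≡ false → marked d ≡ false → D c d ≡ 0ℤ)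
  (∑-marked : ∀ (g : ℕ → ℤ) → ∑ L (λ x → when (marked x) (g x)) ≡ g m₁ +ᶻ g m₂ +ᶻ g m₃ +ᶻ g m₄) where

  unmarked : ℕ → Bool
  unmarked x = not (marked x)

  row col : ℕ → ℤ
  row q = D q m₁ +ᶻ D q m₂ +ᶻ D q m₃ +ᶻ D q m₄
  col q = D m₁ q +ᶻ D m₂ q +ᶻ D m₃ q +ᶻ D m₄ q

  core : ℤ
  core = row m₁ +ᶻ row m₂ +ᶻ row m₃ +ᶻ row m₄

  cross : ℕ → ℤ
  cross q = row q +ᶻ col q

  private
    split-row : ∀ c d → c ∈ L → d ∈ L → D c d ≡ when (marked c) (D c d) +ᶻ when (unmarked c) (when (marked d) (D c d))
    split-row c d cL dL with marked c in ec | marked d in ed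
    ... | true | _ = sym (ZP.+-identityʳ _)
    ... | false | true = sym (ZP.+-identityˡ _)
    ... | false | false = unmarked-vanish c d cL dL ec ed

    split-col : ∀ m d → D m d ≡ when (marked d) (D m d) +ᶻ when (unmarked d) (D m d)
    split-col m d with marked d
    ... | true = sym (ZP.+-identityʳ _)
    ... | false = sym (ZP.+-identityˡ _)

    rowSum : ℕ → ℤ
    rowSum m = ∑ L (D m)

    rest : ℕ → ℤ
    rest m = ∑ L (λ d → when (unmarked d) (D m d))

    rowSum-split : ∀ m → rowSum m ≡ row m +ᶻ rest m
    rowSum-split m = begin
        ∑ L (D m) ≡⟨ ∑-cong L (λ d _ → split-col m d) ⟩
        ∑ L (λ d → when (marked d) (D m d) +ᶻ when (unmarked d) (D m d)) ≡⟨ ∑-distrib-+ L _ _ ⟩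
        ∑ L (λ d → when (marked d) (D m d)) +ᶻ rest m ≡⟨ cong (_+ᶻ rest m) (∑-marked (D m)) ⟩
        row m +ᶻ rest m ∎
      where open ≡-Reasoning

    ∑-col : rest m₁ +ᶻ rest m₂ +ᶻ rest m₃ +ᶻ rest m₄ ≡ ∑ L (λ d → when (unmarked d) (col d))
    ∑-col = sym (begin
        ∑ L (λ d → when (unmarked d) (col d))
          ≡⟨ ∑-cong L (λ d _ → trans (when-distrib-+ (unmarked d) _ _) (cong (_+ᶻ f₄ d) (trans (when-distrib-+ (unmarked d) _ _)
               (cong (_+ᶻ f₃ d) (when-distrib-+ (unmarked d) _ _))))) ⟩
        ∑ L (λ d → f₁ d +ᶻ f₂ d +ᶻ f₃ d +ᶻ f₄ d)
          ≡⟨ trans (∑-distrib-+ L (λ d → f₁ d +ᶻ f₂ d +ᶻ f₃ d) f₄) (cong (_+ᶻ ∑ L f₄)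
               (trans (∑-distrib-+ L (λ d → f₁ d +ᶻ f₂ d) f₃) (cong (_+ᶻ ∑ L f₃) (∑-distrib-+ L f₁ f₂)))) ⟩
        rest m₁ +ᶻ rest m₂ +ᶻ rest m₃ +ᶻ rest m₄ ∎)
      where
        open ≡-Reasoning
        f₁ = λ d → when (unmarked d) (D m₁ d)
        f₂ = λ d → when (unmarked d) (D m₂ d)
        f₃ = λ d → when (unmarked d) (D m₃ d)
        f₄ = λ d → when (unmarked d) (D m₄ d)

  ∑∑-split : ∑ L (λ c → ∑ L (D c)) ≡ core +ᶻ ∑ L (λ q → when (unmarked q) (cross q))
  ∑∑-split = begin
      ∑ L (λ c → ∑ L (D c))
        ≡⟨ ∑-cong L (λ c cL → trans (∑-cong L (λ d dL → split-row c d cL dL)) (trans (∑-distrib-+ L _ _)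
             (cong₂ _+ᶻ_ (∑-when L (marked c) (D c)) (trans (∑-when L (unmarked c) _) (cong (when (unmarked c)) (∑-marked (D c))))))) ⟩
      ∑ L (λ c → when (marked c) (rowSum c) +ᶻ when (unmarked c) (row c))
        ≡⟨ ∑-distrib-+ L _ _ ⟩
      ∑ L (λ c → when (marked c) (rowSum c)) +ᶻ rw
        ≡⟨ cong (_+ᶻ rw) (∑-marked rowSum) ⟩
      rowSum m₁ +ᶻ rowSum m₂ +ᶻ rowSum m₃ +ᶻ rowSum m₄ +ᶻ rw
        ≡⟨ cong (_+ᶻ rw) (cong₂ _+ᶻ_ (cong₂ _+ᶻ_ (cong₂ _+ᶻ_ (rowSum-split m₁) (rowSum-split m₂)) (rowSum-split m₃)) (rowSum-split m₄)) ⟩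
      (row m₁ +ᶻ rest m₁) +ᶻ (row m₂ +ᶻ rest m₂) +ᶻ (row m₃ +ᶻ rest m₃) +ᶻ (row m₄ +ᶻ rest m₄) +ᶻ rw
        ≡⟨ regroup (row m₁) (row m₂) (row m₃) (row m₄) (rest m₁) (rest m₂) (rest m₃) (rest m₄) rw ⟩
      core +ᶻ ((rest m₁ +ᶻ rest m₂ +ᶻ rest m₃ +ᶻ rest m₄) +ᶻ rw)
        ≡⟨ cong (λ z → core +ᶻ (z +ᶻ rw)) ∑-col ⟩
      core +ᶻ (∑ L (λ d → when (unmarked d) (col d)) +ᶻ rw)
        ≡⟨ cong (core +ᶻ_) (trans (sym (∑-distrib-+ L _ _))
             (∑-cong L (λ q _ → trans (sym (when-distrib-+ (unmarked q) _ _)) (cong (when (unmarked q)) (ZP.+-comm (col q) (row q)))))) ⟩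
      core +ᶻ ∑ L (λ q → when (unmarked q) (cross q)) ∎
    where
      open ≡-Reasoning
      rw = ∑ L (λ c → when (unmarked c) (row c))
      regroup : ∀ r₁ r₂ r₃ r₄ x₁ x₂ x₃ x₄ y → (r₁ +ᶻ x₁) +ᶻ (r₂ +ᶻ x₂) +ᶻ (r₃ +ᶻ x₃) +ᶻ (r₄ +ᶻ x₄) +ᶻ y
                                              ≡ (r₁ +ᶻ r₂ +ᶻ r₃ +ᶻ r₄) +ᶻ ((x₁ +ᶻ x₂ +ᶻ x₃ +ᶻ x₄) +ᶻ y)
      regroup = solve-∀

-- Boolean truth tables, checked by evaluation

_⇒ᵇ_ : Bool → Bool → Bool
true ⇒ᵇ y = y
false ⇒ᵇ y = true

_⇔ᵇ_ : Bool → Bool → Bool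
x ⇔ᵇ y = (x ⇒ᵇ y) ∧ (y ⇒ᵇ x)

T⇒≡true : ∀ {x} → T x → x ≡ true
T⇒≡true {true} _ = refl

≡true⇒T : ∀ {x} → x ≡ true → T x
≡true⇒T refl = _

T-∧ˡ : ∀ {x y} → T (x ∧ y) → T x
T-∧ˡ {true} _ = _

T-∧ʳ : ∀ {x y} → T (x ∧ y) → T y
T-∧ʳ {true} h = h

T-∧⁺ : ∀ {x y} → T x → T y → T (x ∧ y)
T-∧⁺ {true} {true} _ _ = _

xor≡true⁻ : ∀ {x y} → (x xor y) ≡ true → (x ≡ true × y ≡ false) ⊎ (x ≡ false × y ≡ true)
xor≡true⁻ {true} {false} _ = inj₁ (refl , refl)
xor≡true⁻ {false} {true} _ = inj₂ (refl , refl)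

∨-trueˡ : ∀ {x y} → x ≡ true → (x ∨ y) ≡ true
∨-trueˡ refl = refl

∨-trueʳ : ∀ {x y} → y ≡ true → (x ∨ y) ≡ true
∨-trueʳ {true} refl = refl
∨-trueʳ {false} refl = refl

true≢false : true ≢ false
true≢false ()

∨-false⁻ : ∀ {x y} → (x ∨ y) ≡ false → (x ≡ false) × (y ≡ false)
∨-false⁻ {false} {false} _ = refl , refl

T-∨⁻ : ∀ {x y} → T (x ∨ y) → T x ⊎ T y
T-∨⁻ {true} h = inj₁ h
T-∨⁻ {false} h = inj₂ h

T-⇒ᵇ⁻ : ∀ {x y} → T (x ⇒ᵇ y) → T x → T y
T-⇒ᵇ⁻ {true} h _ = h

T-⇒ᵇ⁺ : ∀ {x y} → (T x → T y) → T (x ⇒ᵇ y)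
T-⇒ᵇ⁺ {true} f = f _
T-⇒ᵇ⁺ {false} f = _

T-⇒ᵇ⁺′ : ∀ {x y} → (x ≡ true → y ≡ true) → T (x ⇒ᵇ y)
T-⇒ᵇ⁺′ {true} f = ≡true⇒T (f refl)
T-⇒ᵇ⁺′ {false} f = _

T-⇔ᵇ⁺ : ∀ {x y} → x ≡ y → T (x ⇔ᵇ y)
T-⇔ᵇ⁺ {true} refl = _
T-⇔ᵇ⁺ {false} refl = _

T-not⁻ : ∀ {x} → T (not x) → x ≡ false
T-not⁻ {false} _ = refl

T-not⁺ : ∀ {x} → x ≡ false → T (not x)
T-not⁺ refl = _

T-not-≤ᵇ⁻ : ∀ {x y} → T (not (x Z.≤ᵇ y)) → ¬ (x ≤ᶻ y)
T-not-≤ᵇ⁻ t h = subst T (T-not⁻ t) (ZP.≤⇒≤ᵇ h)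

T-not-≤ᵇ⁺ : ∀ {x y} → ¬ (x ≤ᶻ y) → T (not (x Z.≤ᵇ y))
T-not-≤ᵇ⁺ {x} {y} h with x Z.≤ᵇ y in e
... | true = ⊥-elim (h (ZP.≤ᵇ⇒≤ (subst T (sym e) _)))
... | false = _

BoolFn : ℕ → Set
BoolFn zero = Bool
BoolFn (suc k) = Bool → BoolFn k

Valid : ∀ k → BoolFn k → Set
Valid zero b = T b
Valid (suc k) P = ∀ x → Valid k (P x)

allᵇ : ∀ k → BoolFn k → Bool
allᵇ zero b = b
allᵇ (suc k) P = allᵇ k (P true) ∧ allᵇ k (P false)

allᵇ-sound : ∀ k (P : BoolFn k) → T (allᵇ k P) → Valid k P
allᵇ-sound zero b t = t
allᵇ-sound (suc k) P t true = allᵇ-sound k (P true) (T-∧ˡ t)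
allᵇ-sound (suc k) P t false = allᵇ-sound k (P false) (T-∧ʳ {allᵇ k (P true)} t)

isOne : ℤ → Bool
isOne x = (x Z.≤ᵇ 1ℤ) ∧ (1ℤ Z.≤ᵇ x)

isOne⁺ : ∀ {x} → x ≡ 1ℤ → T (isOne x)
isOne⁺ refl = _

-- Change of the inversion indicator of a pair whose root-ness is r₁ ∧ r₂,
-- from "inverted before" to "inverted after".
invChange : (r₁ r₂ after before : Bool) → ℤ
invChange r₁ r₂ after before = when (r₁ ∧ r₂) (when after 1ℤ) -ᶻ when (r₁ ∧ r₂) (when before 1ℤ)

-- A pair that is not a positive root, written 0 − 0 so that the tables match 'cross' and 'core' term by term.
noInvChange : ℤ
noInvChange = 0ℤ -ᶻ 0ℤ

-- The length change contributed by the class {q, q̄} of a letter q ≤ n outside {a, b}, written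
-- in the Boolean data  A = [q < a], B = [q < b],  and, for v = w(q),
-- r₃ = [v < Ȳ], r₄ = [v < X], r₇ = [v < X̄], r₈ = [v < Y]  where X = w(a), Y = w(b).
-- Each summand is one of the 16 pairs between {q, q̄} and {a, b, b̄, ā}, in the order of 'cross'.
ΔclassLow ΔclassHigh Δclass : (A B r₃ r₄ r₇ r₈ : Bool) → ℤ
ΔclassLow A B r₃ r₄ r₇ r₈ =
  (((invChange A true (not r₃) (not r₄) +ᶻ invChange B true (not r₇) (not r₈)) +ᶻ invChange true B (not r₄) (not r₃)) +ᶻ invChange true A (not r₈) (not r₇))
  +ᶻ (((invChange (not A) true r₃ r₄ +ᶻ invChange (not B) true r₇ r₈) +ᶻ noInvChange) +ᶻ noInvChange)
ΔclassHigh A B r₃ r₄ r₇ r₈ =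
  (((noInvChange +ᶻ noInvChange) +ᶻ noInvChange) +ᶻ noInvChange)
  +ᶻ (((invChange true (not A) (not r₈) (not r₇) +ᶻ invChange true (not B) (not r₄) (not r₃)) +ᶻ noInvChange) +ᶻ noInvChange)
Δclass A B r₃ r₄ r₇ r₈ = ΔclassLow A B r₃ r₄ r₇ r₈ +ᶻ ΔclassHigh A B r₃ r₄ r₇ r₈

-- The order relations forced by a < b and X < Ȳ (hence Y < X̄).
ascentOrder : (A B r₃ r₄ r₇ r₈ : Bool) → Bool
ascentOrder A B r₃ r₄ r₇ r₈ = (A ⇒ᵇ B) ∧ (r₄ ⇒ᵇ r₃) ∧ (r₈ ⇒ᵇ r₇)

-- q > b and w(q) lies strictly between X and Ȳ, or between Y and X̄.
straddles : (A B r₃ r₄ r₇ r₈ : Bool) → Bool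
straddles A B r₃ r₄ r₇ r₈ = not B ∧ ((not r₄ ∧ r₃) ∨ (not r₈ ∧ r₇))

Δclass-nonneg : ∀ A B r₃ r₄ r₇ r₈ → T (ascentOrder A B r₃ r₄ r₇ r₈) → 0ℤ ≤ᶻ Δclass A B r₃ r₄ r₇ r₈
Δclass-nonneg A B r₃ r₄ r₇ r₈ o = ZP.≤ᵇ⇒≤ (T-⇒ᵇ⁻ (allᵇ-sound 6 (λ A B r₃ r₄ r₇ r₈ →
  ascentOrder A B r₃ r₄ r₇ r₈ ⇒ᵇ (0ℤ Z.≤ᵇ Δclass A B r₃ r₄ r₇ r₈)) _ A B r₃ r₄ r₇ r₈) o)

Δclass-straddle : ∀ A B r₃ r₄ r₇ r₈ → T (ascentOrder A B r₃ r₄ r₇ r₈) → T (straddles A B r₃ r₄ r₇ r₈) → + 2 ≤ᶻ Δclass A B r₃ r₄ r₇ r₈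
Δclass-straddle A B r₃ r₄ r₇ r₈ o s = ZP.≤ᵇ⇒≤ (T-⇒ᵇ⁻ (allᵇ-sound 6 (λ A B r₃ r₄ r₇ r₈ →
  (ascentOrder A B r₃ r₄ r₇ r₈ ∧ straddles A B r₃ r₄ r₇ r₈) ⇒ᵇ (+ 2 Z.≤ᵇ Δclass A B r₃ r₄ r₇ r₈)) _ A B r₃ r₄ r₇ r₈) (T-∧⁺ o s))

Δclass-bound : ∀ A B r₃ r₄ r₇ r₈ → T (ascentOrder A B r₃ r₄ r₇ r₈) → Δclass A B r₃ r₄ r₇ r₈ ≤ᶻ when (not A) (+ 2) +ᶻ when (not B) (+ 2)
Δclass-bound A B r₃ r₄ r₇ r₈ o = ZP.≤ᵇ⇒≤ (T-⇒ᵇ⁻ (allᵇ-sound 6 (λ A B r₃ r₄ r₇ r₈ →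
  ascentOrder A B r₃ r₄ r₇ r₈ ⇒ᵇ (Δclass A B r₃ r₄ r₇ r₈ Z.≤ᵇ (when (not A) (+ 2) +ᶻ when (not B) (+ 2)))) _ A B r₃ r₄ r₇ r₈) o)

-- The length change contributed by the pairs inside {a, b, b̄, ā}, written in
-- e₁ = [Y < X], e₂ = [X < X̄], e₃ = [Y < Ȳ], e₄ = [X < Ȳ]; the terms are in the order of 'core'.
Δcore : (e₁ e₂ e₃ e₄ : Bool) → ℤ
Δcore e₁ e₂ e₃ e₄ =
  ((((noInvChange +ᶻ invChange true true e₁ e₁) +ᶻ invChange true true e₄ (not e₄)) +ᶻ invChange true true e₃ (not e₂))
  +ᶻ (((noInvChange +ᶻ noInvChange) +ᶻ invChange true true e₂ (not e₃)) +ᶻ noInvChange))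
  +ᶻ (((noInvChange +ᶻ noInvChange) +ᶻ noInvChange) +ᶻ noInvChange)
  +ᶻ (((noInvChange +ᶻ noInvChange) +ᶻ noInvChange) +ᶻ noInvChange)

-- X < Ȳ, and X, Y are not both barred.
ascentCore : (e₁ e₂ e₃ e₄ : Bool) → Bool
ascentCore e₁ e₂ e₃ e₄ = e₄ ∧ (e₂ ∨ e₃)

Δcore-positive : ∀ e₁ e₂ e₃ e₄ → T (ascentCore e₁ e₂ e₃ e₄) → 1ℤ ≤ᶻ Δcore e₁ e₂ e₃ e₄
Δcore-positive e₁ e₂ e₃ e₄ c = ZP.≤ᵇ⇒≤ (T-⇒ᵇ⁻ (allᵇ-sound 4 (λ e₁ e₂ e₃ e₄ →
  ascentCore e₁ e₂ e₃ e₄ ⇒ᵇ (1ℤ Z.≤ᵇ Δcore e₁ e₂ e₃ e₄)) _ e₁ e₂ e₃ e₄) c)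

Δcore≤3 : ∀ e₁ e₂ e₃ e₄ → T (ascentCore e₁ e₂ e₃ e₄) → Δcore e₁ e₂ e₃ e₄ ≤ᶻ + 3
Δcore≤3 e₁ e₂ e₃ e₄ c = ZP.≤ᵇ⇒≤ (T-⇒ᵇ⁻ (allᵇ-sound 4 (λ e₁ e₂ e₃ e₄ →
  ascentCore e₁ e₂ e₃ e₄ ⇒ᵇ (Δcore e₁ e₂ e₃ e₄ Z.≤ᵇ + 3)) _ e₁ e₂ e₃ e₄) c)

Δcore-sameSign : ∀ e₁ e₂ e₃ e₄ → T (ascentCore e₁ e₂ e₃ e₄) → T (not (e₂ xor e₃)) → + 3 ≤ᶻ Δcore e₁ e₂ e₃ e₄
Δcore-sameSign e₁ e₂ e₃ e₄ c x = ZP.≤ᵇ⇒≤ (T-⇒ᵇ⁻ (allᵇ-sound 4 (λ e₁ e₂ e₃ e₄ →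
  (ascentCore e₁ e₂ e₃ e₄ ∧ not (e₂ xor e₃)) ⇒ᵇ (+ 3 Z.≤ᵇ Δcore e₁ e₂ e₃ e₄)) _ e₁ e₂ e₃ e₄) (T-∧⁺ c x))

-- Peaks of h along one split column (C, D), for 1 ≤ p < n.  Here
-- u₁ u₂ u₃ u₄ record whether p, p̄, p+1, (p+1)‾ lie in C, and v₁ … v₄ the same for D.
pairingMid : (u₁ u₂ u₃ u₄ : Bool) → ℤ
pairingMid u₁ u₂ u₃ u₄ = (when u₁ 1ℤ -ᶻ when u₂ 1ℤ) -ᶻ (when u₃ 1ℤ -ᶻ when u₄ 1ℤ)

splitColumnMid : (u₁ u₂ u₃ u₄ v₁ v₂ v₃ v₄ : Bool) → Bool
splitColumnMid u₁ u₂ u₃ u₄ v₁ v₂ v₃ v₄ =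
  not (u₁ ∧ u₂) ∧ not (u₃ ∧ u₄) ∧ not (v₁ ∧ v₂) ∧ not (v₃ ∧ v₄) ∧
  ((v₁ ∨ v₂) ⇔ᵇ (u₁ ∨ u₂)) ∧ ((v₃ ∨ v₄) ⇔ᵇ (u₃ ∨ u₄)) ∧
  (((u₁ ∨ u₂) xor (u₃ ∨ u₄)) ⇒ᵇ ((u₁ ⇒ᵇ v₁) ∧ (u₄ ⇒ᵇ v₄) ∧ (v₃ ⇒ᵇ u₃) ∧ (v₂ ⇒ᵇ u₂)))

noOddPeakMid : (u₁ u₂ u₃ u₄ v₁ v₂ v₃ v₄ : Bool) → Bool
noOddPeakMid u₁ u₂ u₃ u₄ v₁ v₂ v₃ v₄ = isOne (pairingMid u₁ u₂ u₃ u₄) ⇒ᵇ not (pairingMid v₁ v₂ v₃ v₄ Z.≤ᵇ 0ℤ)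

plusWitnessMid : (u₁ u₂ u₃ u₄ v₁ v₂ v₃ v₄ : Bool) → Bool
plusWitnessMid u₁ u₂ u₃ u₄ v₁ v₂ v₃ v₄ =
  (u₁ ∧ v₁ ∧ not u₄ ∧ not v₄ ∧ not u₂ ∧ not u₃ ∧ not v₂ ∧ not v₃) ∨
  (u₄ ∧ v₄ ∧ not u₁ ∧ not v₁ ∧ not u₂ ∧ not u₃ ∧ not v₂ ∧ not v₃)

evenPeakMid : (u₁ u₂ u₃ u₄ v₁ v₂ v₃ v₄ : Bool) → Bool
evenPeakMid u₁ u₂ u₃ u₄ v₁ v₂ v₃ v₄ =
  (isOne (pairingMid v₁ v₂ v₃ v₄) ∧ not (pairingMid u₁ u₂ u₃ u₄ +ᶻ 1ℤ Z.≤ᵇ 0ℤ)) ⇒ᵇ plusWitnessMid u₁ u₂ u₃ u₄ v₁ v₂ v₃ v₄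

peakTableMid : ∀ u₁ u₂ u₃ u₄ v₁ v₂ v₃ v₄ → T (splitColumnMid u₁ u₂ u₃ u₄ v₁ v₂ v₃ v₄) →
  T (noOddPeakMid u₁ u₂ u₃ u₄ v₁ v₂ v₃ v₄) × T (evenPeakMid u₁ u₂ u₃ u₄ v₁ v₂ v₃ v₄)
peakTableMid u₁ u₂ u₃ u₄ v₁ v₂ v₃ v₄ h = T-∧ˡ both , T-∧ʳ {noOddPeakMid u₁ u₂ u₃ u₄ v₁ v₂ v₃ v₄} both
  where
    both = T-⇒ᵇ⁻ (allᵇ-sound 8 (λ u₁ u₂ u₃ u₄ v₁ v₂ v₃ v₄ → splitColumnMid u₁ u₂ u₃ u₄ v₁ v₂ v₃ v₄ ⇒ᵇ
             (noOddPeakMid u₁ u₂ u₃ u₄ v₁ v₂ v₃ v₄ ∧ evenPeakMid u₁ u₂ u₃ u₄ v₁ v₂ v₃ v₄)) _ u₁ u₂ u₃ u₄ v₁ v₂ v₃ v₄) h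

-- The same for p ∈ {0, n}, where P⁺ = {l⁺} and P⁻ = {l⁻} are single letters and the pairing
-- is [l⁺ ∈ C] − [l⁻ ∈ C]; u₁ u₂ (v₁ v₂) record l⁺, l⁻ ∈ C (∈ D).
pairingEnd : (u₁ u₂ : Bool) → ℤ
pairingEnd u₁ u₂ = when u₁ 1ℤ -ᶻ when u₂ 1ℤ

splitColumnEnd : (u₁ u₂ v₁ v₂ : Bool) → Bool
splitColumnEnd u₁ u₂ v₁ v₂ = not (u₁ ∧ u₂) ∧ not (v₁ ∧ v₂) ∧ ((v₁ ∨ v₂) ⇔ᵇ (u₁ ∨ u₂)) ∧ (u₁ ⇒ᵇ v₁) ∧ (v₂ ⇒ᵇ u₂)

peakTableEnd : ∀ u₁ u₂ v₁ v₂ → T (splitColumnEnd u₁ u₂ v₁ v₂) →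
  T (isOne (pairingEnd u₁ u₂) ⇒ᵇ not (pairingEnd v₁ v₂ Z.≤ᵇ 0ℤ)) ×
  T ((isOne (pairingEnd v₁ v₂) ∧ not (pairingEnd u₁ u₂ +ᶻ 1ℤ Z.≤ᵇ 0ℤ)) ⇒ᵇ (u₁ ∧ v₁ ∧ not u₂ ∧ not v₂))
peakTableEnd u₁ u₂ v₁ v₂ h = T-∧ˡ both , T-∧ʳ {isOne (pairingEnd u₁ u₂) ⇒ᵇ not (pairingEnd v₁ v₂ Z.≤ᵇ 0ℤ)} both
  where
    both = T-⇒ᵇ⁻ (allᵇ-sound 4 (λ u₁ u₂ v₁ v₂ → splitColumnEnd u₁ u₂ v₁ v₂ ⇒ᵇ
             ((isOne (pairingEnd u₁ u₂) ⇒ᵇ not (pairingEnd v₁ v₂ Z.≤ᵇ 0ℤ)) ∧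
              ((isOne (pairingEnd v₁ v₂) ∧ not (pairingEnd u₁ u₂ +ᶻ 1ℤ Z.≤ᵇ 0ℤ)) ⇒ᵇ (u₁ ∧ v₁ ∧ not u₂ ∧ not v₂)))) _ u₁ u₂ v₁ v₂) h

module TypeCColumns (n : ℕ) where
  open TypeC n

  2n+1 : ℕ
  2n+1 = suc (2 * n)

  IsLetter : ℕ → Set
  IsLetter x = 1 ≤ x × x ≤ 2 * n

  n≤2n : n ≤ 2 * n
  n≤2n = m≤m+n n (n + 0)

  letter : ∀ {x} → 1 ≤ x → x ≤ n → IsLetter x
  letter h1 h2 = h1 , ≤-trans h2 n≤2n

  letter≤2n+1 : ∀ {x} → IsLetter x → x ≤ 2n+1
  letter≤2n+1 (_ , h) = m≤n⇒m≤1+n h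

  bar-bar : ∀ {x} → x ≤ 2n+1 → bar (bar x) ≡ x
  bar-bar h = m∸[m∸n]≡n h

  bar-anti : ∀ {x y} → y ≤ 2n+1 → x < y → bar y < bar x
  bar-anti y≤ x<y = ∸-monoʳ-< x<y y≤

  bar-anti' : ∀ {x y} → x ≤ 2n+1 → bar y < bar x → x < y
  bar-anti' x≤ lt = ∸-cancelʳ-< lt

  bar-letter : ∀ {x} → IsLetter x → IsLetter (bar x)
  bar-letter {x} (h1 , h2) = m<n⇒0<n∸m (s≤s h2) , ∸-monoʳ-≤ 2n+1 h1

  n+n : 2 * n ≡ n + n
  n+n = cong (λ zz → n + zz) (+-identityʳ n)

  bar-small : ∀ {x} → x ≤ n → n < bar x
  bar-small {x} x≤n = begin-strict
      n           ≡⟨ sym (m+n∸n≡m n n) ⟩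
      n + n ∸ n   <⟨ ∸-monoˡ-< (n<1+n (n + n)) (m≤n+m n n) ⟩
      suc (n + n) ∸ n ≤⟨ ∸-monoʳ-≤ (suc (n + n)) x≤n ⟩
      suc (n + n) ∸ x ≡⟨ cong (λ z → suc z ∸ x) (sym n+n) ⟩
      bar x ∎
    where open ≤-Reasoning

  bar-big : ∀ {x} → n < x → bar x ≤ n
  bar-big {x} n<x = begin
      suc (2 * n) ∸ x ≤⟨ ∸-monoʳ-≤ (suc (2 * n)) n<x ⟩
      suc (2 * n) ∸ suc n ≡⟨ cong (_∸ n) n+n ⟩
      n + n ∸ n ≡⟨ m+n∸n≡m n n ⟩
      n ∎
    where open ≤-Reasoning

  x<ᵇx̄≡x≤ᵇn : ∀ {x} → IsLetter x → (x <ᵇ bar x) ≡ (x ≤ᵇ n)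
  x<ᵇx̄≡x≤ᵇn {x} lx with x ≤? n
  ... | yes h = trans (<⇒<ᵇt (≤-<-trans h (bar-small h))) (sym (≤⇒≤ᵇt h))
  ... | no h = trans (≤⇒<ᵇf (<⇒≤ (≤-<-trans (bar-big (≰⇒> h)) (≰⇒> h)))) (sym (≰⇒≤ᵇf h))

  bar-inj : ∀ {x y} → x ≤ 2n+1 → y ≤ 2n+1 → bar x ≡ bar y → x ≡ y
  bar-inj hx hy e = trans (sym (bar-bar hx)) (trans (cong bar e) (bar-bar hy))

  bar-≢ : ∀ {x} → bar x ≢ x
  bar-≢ {x} e = x+x≢1+y+y x n (trans (cong (λ zz → x + zz) (sym e)) (trans (m+[n∸m]≡n x≤) (cong suc n+n)))
    where
      x≤ : x ≤ 2n+1
      x≤ = ≤-trans (≤-reflexive (sym e)) (m∸n≤m 2n+1 x)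

  swap-a : ∀ a b → swap a b a ≡ b
  swap-a a b rewrite ≡ᵇ-refl a = refl

  swap-b : ∀ a b → swap a b b ≡ a
  swap-b a b with b ≡ᵇ a in e
  ... | true = ≡ᵇ⇒ e
  ... | false rewrite ≡ᵇ-refl b = refl

  swap-o : ∀ {a b x} → x ≢ a → x ≢ b → swap a b x ≡ x
  swap-o {a} {b} {x} h1 h2 rewrite ≢⇒≡ᵇf h1 | ≢⇒≡ᵇf h2 = refl

  swap-invol : ∀ a b x → swap a b (swap a b x) ≡ x
  swap-invol a b x with x ≟ a | x ≟ b
  ... | yes refl | _ rewrite swap-a x b = swap-b x b
  ... | no ne | yes refl rewrite swap-b a x = swap-a a x
  ... | no ne1 | no ne2 rewrite swap-o ne1 ne2 = swap-o ne1 ne2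

  swap-Let : ∀ {a b x} → IsLetter a → IsLetter b → IsLetter x → IsLetter (swap a b x)
  swap-Let {a} {b} {x} la lb lx with x ≟ a | x ≟ b
  ... | yes refl | _ rewrite swap-a x b = lb
  ... | no ne | yes refl rewrite swap-b a x = la
  ... | no ne1 | no ne2 rewrite swap-o ne1 ne2 = lx

  swap-bar : ∀ {a b x} → IsLetter a → IsLetter b → IsLetter x → bar (swap a b x) ≡ swap (bar a) (bar b) (bar x)
  swap-bar {a} {b} {x} la lb lx with x ≟ a | x ≟ b
  ... | yes refl | _ rewrite swap-a x b | swap-a (bar x) (bar b) = refl
  ... | no ne | yes refl rewrite swap-b a x | swap-b (bar a) (bar x) = refl
  ... | no ne1 | no ne2 rewrite swap-o ne1 ne2 =
        sym (swap-o (λ e → ne1 (bar-inj (letter≤2n+1 lx) (letter≤2n+1 la) e)) (λ e → ne2 (bar-inj (letter≤2n+1 lx) (letter≤2n+1 lb) e)))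

  swap-sym : ∀ a b x → swap a b x ≡ swap b a x
  swap-sym a b x with x ≟ a | x ≟ b
  ... | yes refl | yes refl = refl
  ... | yes refl | no ne rewrite swap-a x b | swap-b b x = refl
  ... | no ne | yes refl rewrite swap-b a x | swap-a x a = refl
  ... | no ne1 | no ne2 rewrite swap-o ne1 ne2 | swap-o ne2 ne1 = refl

  swap-comm : ∀ {a b c d} → c ≢ a → c ≢ b → d ≢ a → d ≢ b → ∀ x → swap a b (swap c d x) ≡ swap c d (swap a b x)
  swap-comm {a} {b} {c} {d} ca cb da db x with x ≟ a | x ≟ b | x ≟ c | x ≟ d
  ... | yes refl | _ | yes refl | _ = ⊥-elim (ca refl)
  ... | yes refl | _ | no _ | yes refl = ⊥-elim (da refl)
  ... | yes refl | _ | no xc | no xd rewrite swap-o xc xd | swap-a x b = sym (swap-o (λ e → cb (sym e)) (λ e → db (sym e)))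
  ... | no _ | yes refl | yes refl | _ = ⊥-elim (cb refl)
  ... | no _ | yes refl | no _ | yes refl = ⊥-elim (db refl)
  ... | no xa | yes refl | no xc | no xd rewrite swap-o xc xd | swap-b a x = sym (swap-o (λ e → ca (sym e)) (λ e → da (sym e)))
  ... | no xa | no xb | yes refl | _ rewrite swap-o xa xb | swap-a x d = swap-o (λ e → da e) (λ e → db e)
  ... | no xa | no xb | no xc | yes refl rewrite swap-o xa xb | swap-b c x = swap-o ca cb
  ... | no xa | no xb | no xc | no xd rewrite swap-o xa xb | swap-o xc xd = swap-o xa xb

  module Reflection {u v : ℕ} (lu : IsLetter u) (lv : IsLetter v) where
    s : ℕ → ℕ
    s = sRefl (u , v)

    private
      u≤ = letter≤2n+1 lu
      v≤ = letter≤2n+1 lv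

    s-Let : ∀ {x} → IsLetter x → IsLetter (s x)
    s-Let {x} lx with v ≡ᵇ bar u
    ... | true = swap-Let lu lv lx
    ... | false = swap-Let lu lv (swap-Let (bar-letter lu) (bar-letter lv) lx)

    comm : (v ≡ᵇ bar u) ≡ false → ∀ x → swap u v (swap (bar u) (bar v) x) ≡ swap (bar u) (bar v) (swap u v x)
    comm e = swap-comm bar-≢ (λ h → ≡ᵇf⇒≢ {v} {bar u} e (sym h))
                (λ h → ≡ᵇf⇒≢ {v} {bar u} e (trans (sym (bar-bar v≤)) (cong bar h)))
                bar-≢

    s-invol : ∀ x → s (s x) ≡ x
    s-invol x with v ≡ᵇ bar u in e
    ... | true = swap-invol u v x
    ... | false = begin
          swap u v (swap (bar u) (bar v) (swap u v (swap (bar u) (bar v) x)))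
            ≡⟨ cong (swap u v) (sym (comm e (swap (bar u) (bar v) x))) ⟩
          swap u v (swap u v (swap (bar u) (bar v) (swap (bar u) (bar v) x)))
            ≡⟨ swap-invol u v _ ⟩
          swap (bar u) (bar v) (swap (bar u) (bar v) x)
            ≡⟨ swap-invol _ _ x ⟩
          x ∎
      where open ≡-Reasoning

    s-bar : ∀ {x} → IsLetter x → s (bar x) ≡ bar (s x)
    s-bar {x} lx with v ≡ᵇ bar u in e
    ... | true = begin
          swap u v (bar x)        ≡⟨ swap-sym u v (bar x) ⟩
          swap v u (bar x)        ≡⟨ cong₂ (λ p q → swap p q (bar x)) (≡ᵇ⇒ {v} {bar u} e) (sym (bar-bar u≤)) ⟩
          swap (bar u) (bar (bar u)) (bar x) ≡⟨ cong (λ p → swap (bar u) (bar p) (bar x)) (sym (≡ᵇ⇒ {v} {bar u} e)) ⟩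
          swap (bar u) (bar v) (bar x) ≡⟨ sym (swap-bar lu lv lx) ⟩
          bar (swap u v x) ∎
      where open ≡-Reasoning
    ... | false = begin
          swap u v (swap (bar u) (bar v) (bar x))  ≡⟨ comm e (bar x) ⟩
          swap (bar u) (bar v) (swap u v (bar x))  ≡⟨ cong (swap (bar u) (bar v)) (sym step) ⟩
          swap (bar u) (bar v) (bar (swap (bar u) (bar v) x)) ≡⟨ sym (swap-bar lu lv lz) ⟩
          bar (swap u v (swap (bar u) (bar v) x)) ∎
      where
        open ≡-Reasoning
        lz : IsLetter (swap (bar u) (bar v) x)
        lz = swap-Let (bar-letter lu) (bar-letter lv) lx
        step : bar (swap (bar u) (bar v) x) ≡ swap u v (bar x)
        step = trans (swap-bar (bar-letter lu) (bar-letter lv) lx) (cong₂ (λ p q → swap p q (bar x)) (bar-bar u≤) (bar-bar v≤))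

  record SignedPerm (w : ℕ → ℕ) : Set where
    field
      w⁻¹ : ℕ → ℕ
      w-letter : ∀ {x} → IsLetter x → IsLetter (w x)
      w⁻¹-letter : ∀ {x} → IsLetter x → IsLetter (w⁻¹ x)
      w∘w⁻¹ : ∀ {x} → IsLetter x → w (w⁻¹ x) ≡ x
      w⁻¹∘w : ∀ {x} → IsLetter x → w⁻¹ (w x) ≡ x
      w-bar : ∀ {x} → IsLetter x → w (bar x) ≡ bar (w x)

    w-inj : ∀ {x y} → IsLetter x → IsLetter y → w x ≡ w y → x ≡ y
    w-inj lx ly e = trans (sym (w⁻¹∘w lx)) (trans (cong w⁻¹ e) (w⁻¹∘w ly))

    w⁻¹-bar : ∀ {x} → IsLetter x → w⁻¹ (bar x) ≡ bar (w⁻¹ x)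
    w⁻¹-bar {x} lx = begin
        w⁻¹ (bar x)              ≡⟨ cong (λ z → w⁻¹ (bar z)) (sym (w∘w⁻¹ lx)) ⟩
        w⁻¹ (bar (w (w⁻¹ x)))     ≡⟨ cong w⁻¹ (sym (w-bar (w⁻¹-letter lx))) ⟩
        w⁻¹ (w (bar (w⁻¹ x)))     ≡⟨ w⁻¹∘w (bar-letter (w⁻¹-letter lx)) ⟩
        bar (w⁻¹ x) ∎
      where open ≡-Reasoning

  SignedPerm-id : SignedPerm (λ x → x)
  SignedPerm-id = record { w⁻¹ = λ x → x ; w-letter = λ l → l ; w⁻¹-letter = λ l → l ; w∘w⁻¹ = λ _ → refl ; w⁻¹∘w = λ _ → refl ; w-bar = λ _ → refl }

  SignedPerm-reflect : ∀ {w u v} → SignedPerm w → IsLetter u → IsLetter v → SignedPerm (λ x → w (sRefl (u , v) x))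
  SignedPerm-reflect {w} {u} {v} g lu lv = record
    { w⁻¹ = λ x → s (w⁻¹ x)
    ; w-letter = λ lx → w-letter (s-Let lx)
    ; w⁻¹-letter = λ lx → s-Let (w⁻¹-letter lx)
    ; w∘w⁻¹ = λ {x} lx → trans (cong w (s-invol (w⁻¹ x))) (w∘w⁻¹ lx)
    ; w⁻¹∘w = λ {x} lx → trans (cong s (w⁻¹∘w (s-Let lx))) (s-invol x)
    ; w-bar = λ {x} lx → trans (cong w (s-bar lx)) (w-bar (s-Let lx))
    }
    where open SignedPerm g
          open Reflection lu lv

  IsLetterRoot : Root → Set
  IsLetterRoot (u , v) = IsLetter u × IsLetter v

  SignedPerm-mult : ∀ {w} (βs : List Root) → SignedPerm w → All IsLetterRoot βs → SignedPerm (mult w βs)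
  SignedPerm-mult [] g _ = g
  SignedPerm-mult ((u , v) ∷ βs) g ((lu , lv) ∷ ls) = SignedPerm-mult βs (SignedPerm-reflect g lu lv) ls

  -- The length change along a reflection

  inverted : (ℕ → ℕ) → ℕ → ℕ → ℤ
  inverted w c d = + (if (c <ᵇ d) ∧ (c + d ≤ᵇ suc (2 * n)) ∧ (w d <ᵇ w c) then 1 else 0)

  +sum-map : ∀ xs (f : ℕ → ℕ) → + sum (map f xs) ≡ ∑ xs (λ x → + f x)
  +sum-map [] f = refl
  +sum-map (x ∷ xs) f = trans (ZP.pos-+ (f x) (sum (map f xs))) (cong (+ f x +ᶻ_) (+sum-map xs f))

  len≡∑∑ : ∀ w → + len w ≡ ∑ letters (λ c → ∑ letters (λ d → inverted w c d))
  len≡∑∑ w = trans (+sum-map letters _) (∑-cong letters (λ c _ → +sum-map letters _))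

  letters≡ : letters ≡ range 1 (2 * n)
  letters≡ = asc≡range 1 (2 * n)

  ∈⇒Let : ∀ {x} → x ∈ letters → IsLetter x
  ∈⇒Let {x} m with ∈-range⁻ {x} {1} {2 * n} (subst (x ∈_) letters≡ m)
  ... | h1 , h2 = h1 , ≤-pred h2

  bar-cmp : ∀ {x y} → x ≤ 2n+1 → y ≤ 2n+1 → (bar x <ᵇ bar y) ≡ (y <ᵇ x)
  bar-cmp {x} {y} hx hy with y <ᵇ x in e
  ... | true = <⇒<ᵇt (bar-anti hx (<ᵇt⇒< e))
  ... | false = ≮⇒<ᵇf (λ lt → <⇒≱ (bar-anti' {y} {x} hy lt) (<ᵇf⇒≥ {y} {x} e))

  bar-cmpˡ : ∀ {x y} → x ≤ 2n+1 → y ≤ 2n+1 → (bar x <ᵇ y) ≡ (bar y <ᵇ x)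
  bar-cmpˡ {x} {y} hx hy = trans (cong (bar x <ᵇ_) (sym (bar-bar hy))) (bar-cmp hx (m∸n≤m 2n+1 y))

  x+y≤ᵇ2n+1≡x≤ᵇȳ : ∀ {x y} → y ≤ 2n+1 → (x + y ≤ᵇ 2n+1) ≡ (x ≤ᵇ bar y)
  x+y≤ᵇ2n+1≡x≤ᵇȳ {x} {y} hy with x ≤ᵇ bar y in e
  ... | true = ≤⇒≤ᵇt (≤-trans (+-monoˡ-≤ y (≤ᵇ⇒≤ x (bar y) (subst T (sym e) tt))) (≤-reflexive (m∸n+n≡m hy)))
  ... | false = ≰⇒≤ᵇf (λ h → subst T e (≤⇒≤ᵇ (≤-trans (≤-reflexive (sym (m+n∸n≡m x y))) (∸-monoˡ-≤ y h))))

  inverted-eval : ∀ (f : ℕ → ℕ) x y p1 p2 c → (x <ᵇ y) ≡ p1 → (x + y ≤ᵇ 2n+1) ≡ p2 → (f y <ᵇ f x) ≡ c → inverted f x y ≡ when (p1 ∧ p2) (when c 1ℤ)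
  inverted-eval f x y p1 p2 c e1 e2 e3 rewrite e1 | e2 | e3 with p1 | p2 | c
  ... | true | true | true = refl
  ... | true | true | false = refl
  ... | true | false | _ = refl
  ... | false | _ | _ = refl

  inverted-unordered : ∀ (f : ℕ → ℕ) x y → (x <ᵇ y) ≡ false → inverted f x y ≡ 0ℤ
  inverted-unordered f x y e rewrite e = refl

  inverted-nonroot : ∀ (f : ℕ → ℕ) x y → (x + y ≤ᵇ 2n+1) ≡ false → inverted f x y ≡ 0ℤ
  inverted-nonroot f x y e with x <ᵇ y
  ... | false = refl
  ... | true rewrite e = refl

  -- Δ = ℓ(w s_β) − ℓ(w) for β = ε_a + ε_b = (b , ā) with a < b ≤ n, as a change of inversions.
  -- Only pairs meeting {a, b, b̄, ā} can change; they split into the pairs inside that set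
  -- ('core') and, for each other letter q ≤ n, the pairs meeting {q, q̄} ('classTerm').
  module LengthChange (w : ℕ → ℕ) (g : SignedPerm w) (a b : ℕ) (1≤a : 1 ≤ a) (a<b : a < b) (b≤n : b ≤ n) where
    open SignedPerm g

    a≤n : a ≤ n
    a≤n = ≤-trans (<⇒≤ a<b) b≤n
    la : IsLetter a
    la = 1≤a , ≤-trans a≤n n≤2n
    lb : IsLetter b
    lb = ≤-trans 1≤a (<⇒≤ a<b) , ≤-trans b≤n n≤2n
    lb̄ : IsLetter (bar b)
    lb̄ = bar-letter lb
    lā : IsLetter (bar a)
    lā = bar-letter la
    a≤N = letter≤2n+1 la
    b≤N = letter≤2n+1 lb
    n<b̄ : n < bar b
    n<b̄ = bar-small b≤n
    n<ā : n < bar a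
    n<ā = bar-small a≤n
    b̄<ā : bar b < bar a
    b̄<ā = bar-anti b≤N a<b

    a≢b : a ≢ b
    a≢b = <⇒≢ a<b
    a≢b̄ : a ≢ bar b
    a≢b̄ e = <⇒≱ n<b̄ (subst (_≤ n) e a≤n)
    a≢ā : a ≢ bar a
    a≢ā e = bar-≢ (sym e)
    b≢b̄ : b ≢ bar b
    b≢b̄ e = bar-≢ (sym e)
    b≢ā : b ≢ bar a
    b≢ā e = <⇒≱ n<ā (subst (_≤ n) e b≤n)
    b̄≢ā : bar b ≢ bar a
    b̄≢ā = <⇒≢ b̄<ā

    s : ℕ → ℕ
    s = sRefl (b , bar a)

    s-eq : ∀ x → s x ≡ swap b (bar a) (swap (bar b) a x)
    s-eq x rewrite ≢⇒≡ᵇf {bar a} {bar b} (≢-sym b̄≢ā) | bar-bar a≤N = refl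

    s-a : s a ≡ bar b
    s-a rewrite s-eq a | swap-b (bar b) a = swap-o (≢-sym b≢b̄) b̄≢ā
    s-b : s b ≡ bar a
    s-b rewrite s-eq b | swap-o {bar b} {a} {b} b≢b̄ (≢-sym a≢b) = swap-a b (bar a)
    s-b̄ : s (bar b) ≡ a
    s-b̄ rewrite s-eq (bar b) | swap-a (bar b) a = swap-o a≢b a≢ā
    s-ā : s (bar a) ≡ b
    s-ā rewrite s-eq (bar a) | swap-o {bar b} {a} {bar a} (≢-sym b̄≢ā) (≢-sym a≢ā) = swap-b b (bar a)
    s-o : ∀ {x} → x ≢ a → x ≢ b → x ≢ bar b → x ≢ bar a → s x ≡ x
    s-o {x} h1 h2 h3 h4 rewrite s-eq x | swap-o h3 h1 = swap-o h2 h4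

    w' : ℕ → ℕ
    w' x = w (s x)

    X = w a
    Y = w b
    lX : IsLetter X
    lX = w-letter la
    lY : IsLetter Y
    lY = w-letter lb
    X≤N = letter≤2n+1 lX
    Y≤N = letter≤2n+1 lY

    w'a : w' a ≡ bar Y
    w'a = trans (cong w s-a) (w-bar lb)
    w'b : w' b ≡ bar X
    w'b = trans (cong w s-b) (w-bar la)
    w'b̄ : w' (bar b) ≡ X
    w'b̄ = cong w s-b̄
    w'ā : w' (bar a) ≡ Y
    w'ā = cong w s-ā
    wb̄ : w (bar b) ≡ bar Y
    wb̄ = w-bar lb
    wā : w (bar a) ≡ bar X
    wā = w-bar la

    moved : ℕ → Bool
    moved x = (x ≡ᵇ a) ∨ (x ≡ᵇ b) ∨ (x ≡ᵇ bar b) ∨ (x ≡ᵇ bar a)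

    unmoved-fixed : ∀ {x} → moved x ≡ false → s x ≡ x
    unmoved-fixed {x} e with ∨-false⁻ {x ≡ᵇ a} e
    ... | e1 , e' with ∨-false⁻ {x ≡ᵇ b} e'
    ... | e2 , e'' with ∨-false⁻ {x ≡ᵇ bar b} e''
    ... | e3 , e4 = s-o (≡ᵇf⇒≢ e1) (≡ᵇf⇒≢ e2) (≡ᵇf⇒≢ e3) (≡ᵇf⇒≢ e4)

    D : ℕ → ℕ → ℤ
    D c d = inverted w' c d -ᶻ inverted w c d

    unmoved-vanish : ∀ c d → c ∈ letters → d ∈ letters → moved c ≡ false → moved d ≡ false → D c d ≡ 0ℤ
    unmoved-vanish c d _ _ ec ed = trans (cong (_-ᶻ inverted w c d) (cong₂ (λ u v → + (if (c <ᵇ d) ∧ (c + d ≤ᵇ suc (2 * n)) ∧ (v <ᵇ u) then 1 else 0)) (cong w (unmoved-fixed ec)) (cong w (unmoved-fixed ed)))) (ZP.+-inverseʳ (inverted w c d))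

    when-moved : ∀ (f : ℕ → ℤ) x → when (moved x) (f x) ≡ when (x ≡ᵇ a) (f x) +ᶻ when (x ≡ᵇ b) (f x) +ᶻ when (x ≡ᵇ bar b) (f x) +ᶻ when (x ≡ᵇ bar a) (f x)
    when-moved f x with x ≟ a
    ... | yes refl rewrite ≡ᵇ-refl x | ≢⇒≡ᵇf a≢b | ≢⇒≡ᵇf a≢b̄ | ≢⇒≡ᵇf a≢ā = sym (trans (ZP.+-identityʳ _) (trans (ZP.+-identityʳ _) (ZP.+-identityʳ _)))
    ... | no xa with x ≟ b
    ... | yes refl rewrite ≢⇒≡ᵇf xa | ≡ᵇ-refl x | ≢⇒≡ᵇf b≢b̄ | ≢⇒≡ᵇf b≢ā = sym (trans (ZP.+-identityʳ _) (trans (ZP.+-identityʳ _) (ZP.+-identityˡ _)))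
    ... | no xb with x ≟ bar b
    ... | yes refl rewrite ≢⇒≡ᵇf xa | ≢⇒≡ᵇf xb | ≡ᵇ-refl x | ≢⇒≡ᵇf b̄≢ā = sym (trans (ZP.+-identityʳ _) (ZP.+-identityˡ _))
    ... | no xb̄ with x ≟ bar a
    ... | yes refl rewrite ≢⇒≡ᵇf xa | ≢⇒≡ᵇf xb | ≢⇒≡ᵇf xb̄ | ≡ᵇ-refl x = sym (ZP.+-identityˡ _)
    ... | no xā rewrite ≢⇒≡ᵇf xa | ≢⇒≡ᵇf xb | ≢⇒≡ᵇf xb̄ | ≢⇒≡ᵇf xā = refl

    ∑-letters-point : ∀ (f : ℕ → ℤ) y → IsLetter y → ∑ letters (λ x → when (x ≡ᵇ y) (f x)) ≡ f y
    ∑-letters-point f y (h1 , h2) rewrite letters≡ = ∑-range-point (2 * n) 1 y f h1 (s≤s h2)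

    ∑-moved : ∀ (f : ℕ → ℤ) → ∑ letters (λ x → when (moved x) (f x)) ≡ f a +ᶻ f b +ᶻ f (bar b) +ᶻ f (bar a)
    ∑-moved f = begin
        ∑ letters (λ x → when (moved x) (f x)) ≡⟨ ∑-cong letters (λ x _ → when-moved f x) ⟩
        ∑ letters (λ x → g1 x +ᶻ g2 x +ᶻ g3 x +ᶻ g4 x) ≡⟨ trans (∑-distrib-+ letters (λ x → g1 x +ᶻ g2 x +ᶻ g3 x) g4) (cong (_+ᶻ ∑ letters g4) (trans (∑-distrib-+ letters (λ x → g1 x +ᶻ g2 x) g3) (cong (_+ᶻ ∑ letters g3) (∑-distrib-+ letters g1 g2)))) ⟩
        ∑ letters g1 +ᶻ ∑ letters g2 +ᶻ ∑ letters g3 +ᶻ ∑ letters g4 ≡⟨ cong₂ _+ᶻ_ (cong₂ _+ᶻ_ (cong₂ _+ᶻ_ (∑-letters-point f a la) (∑-letters-point f b lb)) (∑-letters-point f (bar b) lb̄)) (∑-letters-point f (bar a) lā) ⟩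
        f a +ᶻ f b +ᶻ f (bar b) +ᶻ f (bar a) ∎
      where
        open ≡-Reasoning
        g1 = λ x → when (x ≡ᵇ a) (f x)
        g2 = λ x → when (x ≡ᵇ b) (f x)
        g3 = λ x → when (x ≡ᵇ bar b) (f x)
        g4 = λ x → when (x ≡ᵇ bar a) (f x)

    open FourPointSplit letters D moved a b (bar b) (bar a) unmoved-vanish ∑-moved public

    Δ : ℤ
    Δ = + len w' -ᶻ + len w

    Δ≡core+∑cross : Δ ≡ core +ᶻ ∑ letters (λ q → when (unmarked q) (cross q))
    Δ≡core+∑cross = begin
        + len w' -ᶻ + len w ≡⟨ cong₂ _-ᶻ_ (len≡∑∑ w') (len≡∑∑ w) ⟩
        ∑ letters (λ c → ∑ letters (λ d → inverted w' c d)) -ᶻ ∑ letters (λ c → ∑ letters (λ d → inverted w c d))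
          ≡⟨ sym (∑-distrib-- letters _ _) ⟩
        ∑ letters (λ c → ∑ letters (λ d → inverted w' c d) -ᶻ ∑ letters (λ d → inverted w c d))
          ≡⟨ ∑-cong letters (λ c _ → sym (∑-distrib-- letters (inverted w' c) (inverted w c))) ⟩
        ∑ letters (λ c → ∑ letters (λ d → D c d)) ≡⟨ ∑∑-split ⟩
        core +ᶻ ∑ letters (λ q → when (unmarked q) (cross q)) ∎
      where open ≡-Reasoning

    Δinv-eval : ∀ x y p1 p2 c1 c2 → (x <ᵇ y) ≡ p1 → (x + y ≤ᵇ 2n+1) ≡ p2 → (w' y <ᵇ w' x) ≡ c1 → (w y <ᵇ w x) ≡ c2 → D x y ≡ invChange p1 p2 c1 c2
    Δinv-eval x y p1 p2 c1 c2 e1 e2 e3 e4 = cong₂ _-ᶻ_ (inverted-eval w' x y p1 p2 c1 e1 e2 e3) (inverted-eval w x y p1 p2 c2 e1 e2 e4)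

    Δinv-unordered : ∀ x y → (x <ᵇ y) ≡ false → D x y ≡ noInvChange
    Δinv-unordered x y e = cong₂ _-ᶻ_ (inverted-unordered w' x y e) (inverted-unordered w x y e)

    Δinv-nonroot : ∀ x y → (x + y ≤ᵇ 2n+1) ≡ false → D x y ≡ noInvChange
    Δinv-nonroot x y e = cong₂ _-ᶻ_ (inverted-nonroot w' x y e) (inverted-nonroot w x y e)

    <ᵇ-cong : ∀ {x y x' y' c} → x ≡ x' → y ≡ y' → (x' <ᵇ y') ≡ c → (x <ᵇ y) ≡ c
    <ᵇ-cong e1 e2 h = trans (cong₂ _<ᵇ_ e1 e2) h

    x+y≤ᵇ2n+1-true : ∀ {x y} → y ≤ 2n+1 → x ≤ bar y → (x + y ≤ᵇ 2n+1) ≡ true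
    x+y≤ᵇ2n+1-true {x} {y} hy h = trans (x+y≤ᵇ2n+1≡x≤ᵇȳ {x} {y} hy) (≤⇒≤ᵇt {x} {bar y} h)
    x+y≤ᵇ2n+1-false : ∀ {x y} → y ≤ 2n+1 → ¬ (x ≤ bar y) → (x + y ≤ᵇ 2n+1) ≡ false
    x+y≤ᵇ2n+1-false {x} {y} hy h = trans (x+y≤ᵇ2n+1≡x≤ᵇȳ {x} {y} hy) (≰⇒≤ᵇf {x} {bar y} h)

    +⁴-cong : ∀ s1 s2 s3 s4 t1 t2 t3 t4 → s1 ≡ t1 → s2 ≡ t2 → s3 ≡ t3 → s4 ≡ t4 → s1 +ᶻ s2 +ᶻ s3 +ᶻ s4 ≡ t1 +ᶻ t2 +ᶻ t3 +ᶻ t4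
    +⁴-cong _ _ _ _ _ _ _ _ refl refl refl refl = refl

    module OtherClass (q : ℕ) (1≤q : 1 ≤ q) (q≤n : q ≤ n) (qa : q ≢ a) (qb : q ≢ b) where
      lq : IsLetter q
      lq = 1≤q , ≤-trans q≤n n≤2n
      q≤N = letter≤2n+1 lq
      n<q̄ : n < bar q
      n<q̄ = bar-small q≤n
      q≢b̄ : q ≢ bar b
      q≢b̄ e = <⇒≱ n<b̄ (subst (_≤ n) e q≤n)
      q≢ā : q ≢ bar a
      q≢ā e = <⇒≱ n<ā (subst (_≤ n) e q≤n)
      q̄≢a : bar q ≢ a
      q̄≢a e = <⇒≱ n<q̄ (subst (_≤ n) (sym e) a≤n)
      q̄≢b : bar q ≢ b
      q̄≢b e = <⇒≱ n<q̄ (subst (_≤ n) (sym e) b≤n)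
      q̄≢b̄ : bar q ≢ bar b
      q̄≢b̄ e = qb (bar-inj q≤N b≤N e)
      q̄≢ā : bar q ≢ bar a
      q̄≢ā e = qa (bar-inj q≤N a≤N e)

      v = w q
      lv : IsLetter v
      lv = w-letter lq
      v≤N = letter≤2n+1 lv
      w'q : w' q ≡ v
      w'q = cong w (s-o qa qb q≢b̄ q≢ā)
      w'q̄ : w' (bar q) ≡ bar v
      w'q̄ = trans (cong w (s-o q̄≢a q̄≢b q̄≢b̄ q̄≢ā)) (w-bar lq)
      wq̄ : w (bar q) ≡ bar v
      wq̄ = w-bar lq

      v≢X : v ≢ X
      v≢X e = qa (w-inj lq la e)
      v≢Y : v ≢ Y
      v≢Y e = qb (w-inj lq lb e)
      v≢Ȳ : v ≢ bar Y
      v≢Ȳ e = q≢b̄ (w-inj lq lb̄ (trans e (sym wb̄)))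
      v≢X̄ : v ≢ bar X
      v≢X̄ e = q≢ā (w-inj lq lā (trans e (sym wā)))

      A = q <ᵇ a
      B = q <ᵇ b
      r3 = v <ᵇ bar Y
      r4 = v <ᵇ X
      r7 = v <ᵇ bar X
      r8 = v <ᵇ Y

      flipv : ∀ {u} → v ≢ u → (u <ᵇ v) ≡ not (v <ᵇ u)
      flipv ne = <ᵇ-flip (≢-sym ne)

      aq : (a <ᵇ q) ≡ not A
      aq = <ᵇ-flip (≢-sym qa)
      bq : (b <ᵇ q) ≡ not B
      bq = <ᵇ-flip (≢-sym qb)

      q≤ā : q ≤ bar a
      q≤ā = <⇒≤ (≤-<-trans q≤n n<ā)
      q≤b̄ : q ≤ bar b
      q≤b̄ = <⇒≤ (≤-<-trans q≤n n<b̄)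
      a≤q̄ : a ≤ bar q
      a≤q̄ = <⇒≤ (≤-<-trans a≤n n<q̄)
      b≤q̄ : b ≤ bar q
      b≤q̄ = <⇒≤ (≤-<-trans b≤n n<q̄)

      cross-q : cross q ≡ ΔclassLow A B r3 r4 r7 r8
      cross-q = cong₂ _+ᶻ_
        (+⁴-cong _ _ _ _ _ _ _ _
          (Δinv-eval q a A true (not r3) (not r4) refl (x+y≤ᵇ2n+1-true {q} {a} a≤N q≤ā) (<ᵇ-cong w'a w'q (flipv v≢Ȳ)) (flipv v≢X))
          (Δinv-eval q b B true (not r7) (not r8) refl (x+y≤ᵇ2n+1-true {q} {b} b≤N q≤b̄) (<ᵇ-cong w'b w'q (flipv v≢X̄)) (flipv v≢Y))
          (Δinv-eval q (bar b) true B (not r4) (not r3) (<⇒<ᵇt (≤-<-trans q≤n n<b̄))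
              (trans (x+y≤ᵇ2n+1≡x≤ᵇȳ {q} {bar b} (letter≤2n+1 lb̄)) (trans (cong (q ≤ᵇ_) (bar-bar b≤N)) (≤ᵇ≡<ᵇ qb)))
              (<ᵇ-cong w'b̄ w'q (flipv v≢X)) (<ᵇ-cong {y' = v} wb̄ refl (flipv v≢Ȳ)))
          (Δinv-eval q (bar a) true A (not r8) (not r7) (<⇒<ᵇt (≤-<-trans q≤n n<ā))
              (trans (x+y≤ᵇ2n+1≡x≤ᵇȳ {q} {bar a} (letter≤2n+1 lā)) (trans (cong (q ≤ᵇ_) (bar-bar a≤N)) (≤ᵇ≡<ᵇ qa)))
              (<ᵇ-cong w'ā w'q (flipv v≢Y)) (<ᵇ-cong {y' = v} wā refl (flipv v≢X̄))))
        (+⁴-cong _ _ _ _ _ _ _ _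
          (Δinv-eval a q (not A) true r3 r4 aq (x+y≤ᵇ2n+1-true {a} {q} q≤N a≤q̄) (<ᵇ-cong w'q w'a refl) refl)
          (Δinv-eval b q (not B) true r7 r8 bq (x+y≤ᵇ2n+1-true {b} {q} q≤N b≤q̄) (<ᵇ-cong w'q w'b refl) refl)
          (Δinv-unordered (bar b) q (≤⇒<ᵇf (<⇒≤ (≤-<-trans q≤n n<b̄))))
          (Δinv-unordered (bar a) q (≤⇒<ᵇf (<⇒≤ (≤-<-trans q≤n n<ā)))))

      cross-q̄ : cross (bar q) ≡ ΔclassHigh A B r3 r4 r7 r8
      cross-q̄ = cong₂ _+ᶻ_
        (+⁴-cong _ _ _ _ _ _ _ _
          (Δinv-unordered (bar q) a (≤⇒<ᵇf (<⇒≤ (≤-<-trans a≤n n<q̄))))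
          (Δinv-unordered (bar q) b (≤⇒<ᵇf (<⇒≤ (≤-<-trans b≤n n<q̄))))
          (Δinv-nonroot (bar q) (bar b) (x+y≤ᵇ2n+1-false {bar q} {bar b} (letter≤2n+1 lb̄) (λ h → <⇒≱ (≤-<-trans b≤n n<q̄) (subst (bar q ≤_) (bar-bar b≤N) h))))
          (Δinv-nonroot (bar q) (bar a) (x+y≤ᵇ2n+1-false {bar q} {bar a} (letter≤2n+1 lā) (λ h → <⇒≱ (≤-<-trans a≤n n<q̄) (subst (bar q ≤_) (bar-bar a≤N) h)))))
        (+⁴-cong _ _ _ _ _ _ _ _
          (Δinv-eval a (bar q) true (not A) (not r8) (not r7) (<⇒<ᵇt (≤-<-trans a≤n n<q̄))
              (trans (x+y≤ᵇ2n+1≡x≤ᵇȳ {a} {bar q} (m∸n≤m 2n+1 q)) (trans (cong (a ≤ᵇ_) (bar-bar q≤N)) (trans (≤ᵇ≡<ᵇ (≢-sym qa)) aq)))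
              (<ᵇ-cong w'q̄ w'a (trans (bar-cmp v≤N Y≤N) (flipv v≢Y)))
              (<ᵇ-cong {y' = X} wq̄ refl (trans (bar-cmpˡ v≤N X≤N) (flipv v≢X̄))))
          (Δinv-eval b (bar q) true (not B) (not r4) (not r3) (<⇒<ᵇt (≤-<-trans b≤n n<q̄))
              (trans (x+y≤ᵇ2n+1≡x≤ᵇȳ {b} {bar q} (m∸n≤m 2n+1 q)) (trans (cong (b ≤ᵇ_) (bar-bar q≤N)) (trans (≤ᵇ≡<ᵇ (≢-sym qb)) bq)))
              (<ᵇ-cong w'q̄ w'b (trans (bar-cmp v≤N X≤N) (flipv v≢X)))
              (<ᵇ-cong {y' = Y} wq̄ refl (trans (bar-cmpˡ v≤N Y≤N) (flipv v≢Ȳ))))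
          (Δinv-nonroot (bar b) (bar q) (x+y≤ᵇ2n+1-false {bar b} {bar q} (m∸n≤m 2n+1 q) (λ h → <⇒≱ (≤-<-trans q≤n n<b̄) (subst (bar b ≤_) (bar-bar q≤N) h))))
          (Δinv-nonroot (bar a) (bar q) (x+y≤ᵇ2n+1-false {bar a} {bar q} (m∸n≤m 2n+1 q) (λ h → <⇒≱ (≤-<-trans q≤n n<ā) (subst (bar a ≤_) (bar-bar q≤N) h)))))

    e1 = Y <ᵇ X
    e2 = X <ᵇ bar X
    e3 = Y <ᵇ bar Y
    e4 = X <ᵇ bar Y

    X≢Ȳ : X ≢ bar Y
    X≢Ȳ e = a≢b̄ (w-inj la lb̄ (trans e (sym wb̄)))

    a≤b̄ : a ≤ bar b
    a≤b̄ = <⇒≤ (≤-<-trans a≤n n<b̄)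

    core≡Δcore : core ≡ Δcore e1 e2 e3 e4
    core≡Δcore = +⁴-cong _ _ _ _ _ _ _ _
      (+⁴-cong _ _ _ _ _ _ _ _
        (Δinv-unordered a a (≤⇒<ᵇf {a} {a} ≤-refl))
        (Δinv-eval a b true true e1 e1 (<⇒<ᵇt a<b) (x+y≤ᵇ2n+1-true {a} {b} b≤N a≤b̄) (<ᵇ-cong w'b w'a (bar-cmp X≤N Y≤N)) refl)
        (Δinv-eval a (bar b) true true e4 (not e4) (<⇒<ᵇt (≤-<-trans a≤n n<b̄)) (x+y≤ᵇ2n+1-true {a} {bar b} (letter≤2n+1 lb̄) (subst (a ≤_) (sym (bar-bar b≤N)) (<⇒≤ a<b)))
            (<ᵇ-cong w'b̄ w'a refl) (<ᵇ-cong {y' = X} wb̄ refl (<ᵇ-flip (≢-sym X≢Ȳ))))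
        (Δinv-eval a (bar a) true true e3 (not e2) (<⇒<ᵇt (≤-<-trans a≤n n<ā)) (x+y≤ᵇ2n+1-true {a} {bar a} (letter≤2n+1 lā) (subst (a ≤_) (sym (bar-bar a≤N)) ≤-refl))
            (<ᵇ-cong w'ā w'a refl) (<ᵇ-cong {y' = X} wā refl (<ᵇ-flip {bar X} {X} bar-≢))))
      (+⁴-cong _ _ _ _ _ _ _ _
        (Δinv-unordered b a (≤⇒<ᵇf (<⇒≤ a<b)))
        (Δinv-unordered b b (≤⇒<ᵇf {b} {b} ≤-refl))
        (Δinv-eval b (bar b) true true e2 (not e3) (<⇒<ᵇt (≤-<-trans b≤n n<b̄)) (x+y≤ᵇ2n+1-true {b} {bar b} (letter≤2n+1 lb̄) (subst (b ≤_) (sym (bar-bar b≤N)) ≤-refl))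
            (<ᵇ-cong w'b̄ w'b refl) (<ᵇ-cong {y' = Y} wb̄ refl (<ᵇ-flip {bar Y} {Y} bar-≢)))
        (Δinv-nonroot b (bar a) (x+y≤ᵇ2n+1-false {b} {bar a} (letter≤2n+1 lā) (λ h → <⇒≱ a<b (subst (b ≤_) (bar-bar a≤N) h)))))
      (+⁴-cong _ _ _ _ _ _ _ _
        (Δinv-unordered (bar b) a (≤⇒<ᵇf (<⇒≤ (≤-<-trans a≤n n<b̄))))
        (Δinv-unordered (bar b) b (≤⇒<ᵇf (<⇒≤ (≤-<-trans b≤n n<b̄))))
        (Δinv-unordered (bar b) (bar b) (≤⇒<ᵇf {bar b} {bar b} ≤-refl))
        (Δinv-nonroot (bar b) (bar a) (x+y≤ᵇ2n+1-false {bar b} {bar a} (letter≤2n+1 lā) (λ h → <⇒≱ (≤-<-trans a≤n n<b̄) (subst (bar b ≤_) (bar-bar a≤N) h)))))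
      (+⁴-cong _ _ _ _ _ _ _ _
        (Δinv-unordered (bar a) a (≤⇒<ᵇf (<⇒≤ (≤-<-trans a≤n n<ā))))
        (Δinv-unordered (bar a) b (≤⇒<ᵇf (<⇒≤ (≤-<-trans b≤n n<ā))))
        (Δinv-unordered (bar a) (bar b) (≤⇒<ᵇf (<⇒≤ b̄<ā)))
        (Δinv-unordered (bar a) (bar a) (≤⇒<ᵇf {bar a} {bar a} ≤-refl)))

    classTerm : ℕ → ℤ
    classTerm q = when (unmarked q) (cross q) +ᶻ when (unmarked (bar q)) (cross (bar q))

    ∑-by-classes : ∑ letters (λ q → when (unmarked q) (cross q)) ≡ ∑ (range 1 n) classTerm
    ∑-by-classes = begin
        ∑ letters H ≡⟨ cong (λ z → ∑ z H) (trans letters≡ (trans (cong (range 1) n+n) (range-++ 1 n n))) ⟩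
        ∑ (range 1 n ++ range (suc n) n) H ≡⟨ ∑-distrib-++ (range 1 n) _ H ⟩
        ∑ (range 1 n) H +ᶻ ∑ (range (suc n) n) H ≡⟨ cong (∑ (range 1 n) H +ᶻ_) (∑-range-reflect H n (suc n) 1 2n+1 ar) ⟩
        ∑ (range 1 n) H +ᶻ ∑ (range 1 n) (λ x → H (2n+1 ∸ x)) ≡⟨ sym (∑-distrib-+ (range 1 n) H (λ x → H (2n+1 ∸ x))) ⟩
        ∑ (range 1 n) classTerm ∎
      where
        open ≡-Reasoning
        H = λ q → when (unmarked q) (cross q)
        ar : suc n + 1 + n ≡ suc 2n+1
        ar = cong suc (trans (+-comm (n + 1) n) (trans (sym (+-assoc n n 1)) (trans (+-comm (n + n) 1) (cong suc (sym n+n)))))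

    Δ≡core+∑classTerm : Δ ≡ core +ᶻ ∑ (range 1 n) classTerm
    Δ≡core+∑classTerm = trans Δ≡core+∑cross (cong (core +ᶻ_) ∑-by-classes)

    unmarked-a : unmarked a ≡ false
    unmarked-a rewrite ≡ᵇ-refl a = refl
    unmarked-ā : unmarked (bar a) ≡ false
    unmarked-ā rewrite ≢⇒≡ᵇf (≢-sym a≢ā) | ≢⇒≡ᵇf (≢-sym b≢ā) | ≢⇒≡ᵇf (≢-sym b̄≢ā) | ≡ᵇ-refl (bar a) = refl
    unmarked-b : unmarked b ≡ false
    unmarked-b rewrite ≢⇒≡ᵇf (≢-sym a≢b) | ≡ᵇ-refl b = refl
    unmarked-b̄ : unmarked (bar b) ≡ false
    unmarked-b̄ rewrite ≢⇒≡ᵇf (≢-sym a≢b̄) | ≢⇒≡ᵇf (≢-sym b≢b̄) | ≡ᵇ-refl (bar b) = refl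

    classTerm-a : classTerm a ≡ 0ℤ
    classTerm-a rewrite unmarked-a | unmarked-ā = refl
    classTerm-b : classTerm b ≡ 0ℤ
    classTerm-b rewrite unmarked-b | unmarked-b̄ = refl

    module OtherClassTerm (q : ℕ) (1≤q : 1 ≤ q) (q≤n : q ≤ n) (qa : q ≢ a) (qb : q ≢ b) where
      open OtherClass q 1≤q q≤n qa qb public

      unmarked-q : unmarked q ≡ true
      unmarked-q rewrite ≢⇒≡ᵇf qa | ≢⇒≡ᵇf qb | ≢⇒≡ᵇf q≢b̄ | ≢⇒≡ᵇf q≢ā = refl
      unmarked-q̄ : unmarked (bar q) ≡ true
      unmarked-q̄ rewrite ≢⇒≡ᵇf q̄≢a | ≢⇒≡ᵇf q̄≢b | ≢⇒≡ᵇf q̄≢b̄ | ≢⇒≡ᵇf q̄≢ā = refl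

      classTerm-q : classTerm q ≡ Δclass A B r3 r4 r7 r8
      classTerm-q rewrite unmarked-q | unmarked-q̄ = cong₂ _+ᶻ_ cross-q cross-q̄

    NoStraddle : Set
    NoStraddle = ∀ q → b < q → q ≤ n → ¬ (X < w q × w q < bar Y) × ¬ (Y < w q × w q < bar X)

    module Ascent (up : X < bar Y) where
      Y<X̄ : Y < bar X
      Y<X̄ = subst (_< bar X) (bar-bar Y≤N) (bar-anti (m∸n≤m 2n+1 Y) up)

      ascentOrder-holds : ∀ q (1≤q : 1 ≤ q) (q≤n : q ≤ n) (qa : q ≢ a) (qb : q ≢ b) → let open OtherClassTerm q 1≤q q≤n qa qb in T (ascentOrder A B r3 r4 r7 r8)
      ascentOrder-holds q 1≤q q≤n qa qb = T-∧⁺ (T-⇒ᵇ⁺′ (λ e → <⇒<ᵇt (<-trans (<ᵇt⇒< e) a<b)))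
                               (T-∧⁺ (T-⇒ᵇ⁺′ (λ e → <⇒<ᵇt (<-trans (<ᵇt⇒< e) up)))
                                    (T-⇒ᵇ⁺′ (λ e → <⇒<ᵇt (<-trans (<ᵇt⇒< e) Y<X̄))))
        where open OtherClassTerm q 1≤q q≤n qa qb

      classTerm-nonneg : ∀ q → q ∈ range 1 n → 0ℤ ≤ᶻ classTerm q
      classTerm-nonneg q m with ∈-range⁻ m | q ≟ a | q ≟ b
      ... | _ | yes refl | _ = ZP.≤-reflexive (sym classTerm-a)
      ... | _ | no _ | yes refl = ZP.≤-reflexive (sym classTerm-b)
      ... | h1 , h2 | no qa | no qb = nn q h1 (≤-pred h2) qa qb
        where
          nn : ∀ q 1≤q q≤n qa qb → 0ℤ ≤ᶻ classTerm q
          nn q 1≤q q≤n qa qb = subst (0ℤ ≤ᶻ_) (sym classTerm-q) (Δclass-nonneg A B r3 r4 r7 r8 (ascentOrder-holds q 1≤q q≤n qa qb))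
            where open OtherClassTerm q 1≤q q≤n qa qb

      classBound : ℕ → ℤ
      classBound q = when (a <ᵇ q) (+ 2) +ᶻ when (b <ᵇ q) (+ 2) -ᶻ when (q ≡ᵇ b) (+ 2)

      classTerm-bound : ∀ q → q ∈ range 1 n → classTerm q ≤ᶻ classBound q
      classTerm-bound q m with ∈-range⁻ m | q ≟ a | q ≟ b
      ... | _ | yes refl | _ rewrite classTerm-a | ≤⇒<ᵇf {q} {q} ≤-refl | ≤⇒<ᵇf (<⇒≤ a<b) | ≢⇒≡ᵇf a≢b = ZP.≤-refl
      ... | _ | no _ | yes refl rewrite classTerm-b | <⇒<ᵇt a<b | ≤⇒<ᵇf {q} {q} ≤-refl | ≡ᵇ-refl q = ZP.≤-refl
      ... | h1 , h2 | no qa | no qb = ub-q q h1 (≤-pred h2) qa qb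
        where
          ub-q : ∀ q 1≤q q≤n qa qb → classTerm q ≤ᶻ classBound q
          ub-q q 1≤q q≤n qa qb rewrite OtherClassTerm.classTerm-q q 1≤q q≤n qa qb | ≢⇒≡ᵇf qb | OtherClassTerm.aq q 1≤q q≤n qa qb | OtherClassTerm.bq q 1≤q q≤n qa qb =
             ZP.≤-trans (Δclass-bound A B r3 r4 r7 r8 (ascentOrder-holds q 1≤q q≤n qa qb)) (ZP.≤-reflexive (sym (ZP.+-identityʳ _)))
            where open OtherClassTerm q 1≤q q≤n qa qb

      straddle⇒classTerm≥2 : ∀ q → b < q → q ≤ n → (X < w q × w q < bar Y) ⊎ (Y < w q × w q < bar X) → + 2 ≤ᶻ classTerm q
      straddle⇒classTerm≥2 q b<q q≤n h = subst (+ 2 ≤ᶻ_) (sym classTerm-q) (Δclass-straddle A B r3 r4 r7 r8 (ascentOrder-holds q 1≤q q≤n qa qb) ht)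
        where
          1≤q : 1 ≤ q
          1≤q = ≤-trans 1≤a (<⇒≤ (<-trans a<b b<q))
          qa : q ≢ a
          qa e = <⇒≢ (<-trans a<b b<q) (sym e)
          qb : q ≢ b
          qb e = <⇒≢ b<q (sym e)
          open OtherClassTerm q 1≤q q≤n qa qb
          Bf : B ≡ false
          Bf = ≤⇒<ᵇf (<⇒≤ b<q)
          ht' : (X < v × v < bar Y) ⊎ (Y < v × v < bar X) → T (straddles A B r3 r4 r7 r8)
          ht' (inj₁ (h1 , h2)) rewrite Bf | ≤⇒<ᵇf {v} {X} (<⇒≤ h1) | <⇒<ᵇt {v} {bar Y} h2 = _
          ht' (inj₂ (h1 , h2)) rewrite Bf | ≤⇒<ᵇf {v} {Y} (<⇒≤ h1) | <⇒<ᵇt {v} {bar X} h2 with not r4 ∧ r3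
          ... | true = _
          ... | false = _
          ht : T (straddles A B r3 r4 r7 r8)
          ht = ht' h

      ascentCore-holds : T (ascentCore e1 e2 e3 e4)
      ascentCore-holds = subst T (sym (cong₂ _∧_ (<⇒<ᵇt up) e23)) _
        where
          e23 : (e2 ∨ e3) ≡ true
          e23 rewrite x<ᵇx̄≡x≤ᵇn lX | x<ᵇx̄≡x≤ᵇn lY with X ≤? n
          ... | yes h rewrite ≤⇒≤ᵇt h = refl
          ... | no h rewrite ≰⇒≤ᵇf h with Y ≤? n
          ...   | yes h' rewrite ≤⇒≤ᵇt h' = refl
          ...   | no h' = ⊥-elim (<⇒≱ up (<⇒≤ (≤-<-trans (bar-big (≰⇒> h')) (≰⇒> h))))

      core≥1 : 1ℤ ≤ᶻ core
      core≥1 = subst (1ℤ ≤ᶻ_) (sym core≡Δcore) (Δcore-positive e1 e2 e3 e4 ascentCore-holds)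
      core≤3 : core ≤ᶻ + 3
      core≤3 = subst (_≤ᶻ + 3) (sym core≡Δcore) (Δcore≤3 e1 e2 e3 e4 ascentCore-holds)

      ∑classTerm-nonneg : 0ℤ ≤ᶻ ∑ (range 1 n) classTerm
      ∑classTerm-nonneg = ∑-nonneg (range 1 n) classTerm-nonneg

      Δ≥1 : 1ℤ ≤ᶻ Δ
      Δ≥1 = subst (1ℤ ≤ᶻ_) (sym Δ≡core+∑classTerm) (ZP.≤-trans core≥1 (≤-+-nonneg ∑classTerm-nonneg))

      when-2≡1+1 : ∀ p → when p (+ 2) ≡ when p 1ℤ +ᶻ when p 1ℤ
      when-2≡1+1 true = refl
      when-2≡1+1 false = refl

      ∑-count->-twice : ∀ c → c ≤ n → ∑ (range 1 n) (λ q → when (c <ᵇ q) (+ 2)) ≡ + (n ∸ c) +ᶻ + (n ∸ c)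
      ∑-count->-twice c c≤n = trans (∑-cong (range 1 n) (λ q _ → when-2≡1+1 (c <ᵇ q)))
                   (trans (∑-distrib-+ (range 1 n) (λ q → when (c <ᵇ q) 1ℤ) (λ q → when (c <ᵇ q) 1ℤ)) (cong₂ _+ᶻ_ (∑-count-> c n c≤n) (∑-count-> c n c≤n)))

      ∑-classBound : ∑ (range 1 n) classBound ≡ (+ (n ∸ a) +ᶻ + (n ∸ a)) +ᶻ (+ (n ∸ b) +ᶻ + (n ∸ b)) -ᶻ + 2
      ∑-classBound = trans (∑-distrib-- (range 1 n) (λ q → when (a <ᵇ q) (+ 2) +ᶻ when (b <ᵇ q) (+ 2)) (λ q → when (q ≡ᵇ b) (+ 2)))
              (cong₂ _-ᶻ_ (trans (∑-distrib-+ (range 1 n) (λ q → when (a <ᵇ q) (+ 2)) (λ q → when (b <ᵇ q) (+ 2))) (cong₂ _+ᶻ_ (∑-count->-twice a a≤n) (∑-count->-twice b b≤n)))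
                          (∑-range-point n 1 b (λ _ → + 2) (≤-trans 1≤a (<⇒≤ a<b)) (s≤s b≤n)))

      Δ≤1+2[n-a]+2[n-b] : Δ ≤ᶻ 1ℤ +ᶻ (+ (n ∸ a) +ᶻ + (n ∸ a)) +ᶻ (+ (n ∸ b) +ᶻ + (n ∸ b))
      Δ≤1+2[n-a]+2[n-b] = subst (_≤ᶻ _) (sym Δ≡core+∑classTerm)
        (ZP.≤-trans (ZP.+-mono-≤ core≤3 (ZP.≤-trans (∑-mono-≤ (range 1 n) classTerm-bound) (ZP.≤-reflexive ∑-classBound)))
                    (ZP.≤-reflexive (alg (+ (n ∸ a)) (+ (n ∸ b)))))
        where alg : ∀ x y → + 3 +ᶻ ((x +ᶻ x) +ᶻ (y +ᶻ y) -ᶻ + 2) ≡ 1ℤ +ᶻ (x +ᶻ x) +ᶻ (y +ᶻ y)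
              alg = solve-∀

      3≰2 : ¬ (+ 3 ≤ᶻ + 2)
      3≰2 (Z.+≤+ (s≤s (s≤s ())))

      Δ≤2⇒cover : Δ ≤ᶻ + 2 → T (e2 xor e3) × NoStraddle
      Δ≤2⇒cover h = xr , nh
        where
          xr : T (e2 xor e3)
          xr with e2 xor e3 in ex
          ... | true = _
          ... | false = ⊥-elim (3≰2 (ZP.≤-trans (ZP.≤-trans (subst (+ 3 ≤ᶻ_) (sym core≡Δcore) (Δcore-sameSign e1 e2 e3 e4 ascentCore-holds (subst (λ z → T (not z)) (sym ex) _))) (≤-+-nonneg ∑classTerm-nonneg)) (subst (_≤ᶻ + 2) Δ≡core+∑classTerm h)))
          nh : NoStraddle
          nh q b<q q≤n = (λ hh → bad (inj₁ hh)) , (λ hh → bad (inj₂ hh))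
            where
              q∈ : q ∈ range 1 n
              q∈ = ∈-range⁺ (≤-trans 1≤a (<⇒≤ (<-trans a<b b<q))) (s≤s q≤n)
              bad : (X < w q × w q < bar Y) ⊎ (Y < w q × w q < bar X) → ⊥
              bad hh = 3≰2 (ZP.≤-trans (ZP.≤-trans (ZP.≤-trans (ZP.≤-reflexive refl) (ZP.+-mono-≤ core≥1 (ZP.≤-trans (straddle⇒classTerm≥2 q b<q q≤n hh) (term≤∑-nonneg (range 1 n) q∈ classTerm-nonneg)))) ZP.≤-refl) (subst (_≤ᶻ + 2) Δ≡core+∑classTerm h))

  -- Quantum Bruhat edges along ε_a + ε_b are Bruhat covers

  len-cong : ∀ {f g : ℕ → ℕ} → (∀ x → IsLetter x → f x ≡ g x) → len f ≡ len g
  len-cong {f} {g} h = cong sum (LP.map-cong-local (tabulate λ {a} ma → cong sum (LP.map-cong-local (tabulate λ {b} mb →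
    cong₂ (λ u v → if (a <ᵇ b) ∧ (a + b ≤ᵇ suc (2 * n)) ∧ (v <ᵇ u) then 1 else 0) (h a (∈⇒Let ma)) (h b (∈⇒Let mb))))))

  BruhatCover : (w : ℕ → ℕ) → ℕ → ℕ → Set
  BruhatCover w a b = (w a < bar (w b)) × T ((w a <ᵇ bar (w a)) xor (w b <ᵇ bar (w b)))
    × (∀ q → b < q → q ≤ n → ¬ (w a < w q × w q < bar (w b)) × ¬ (w b < w q × w q < bar (w a)))

  ρcoroot-b+ā : ∀ a b → 1 ≤ a → a < b → b ≤ n → ρcoroot (b , bar a) ≡ 1ℤ +ᶻ (+ bar a -ᶻ + b)
  ρcoroot-b+ā a b 1≤a a<b b≤n rewrite ≢⇒≡ᵇf {bar a} {bar b} (λ e → LengthChange.b̄≢ā (λ x → x) SignedPerm-id a b 1≤a a<b b≤n (sym e))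
     | ≤⇒≤ᵇt {b} {n} b≤n | ≰⇒≤ᵇf {bar a} {n} (λ h → <⇒≱ (bar-small (≤-trans (<⇒≤ a<b) b≤n)) h) = alg (+ n) (+ b) (+ bar a)
    where alg : ∀ x y z → (1ℤ +ᶻ x) -ᶻ y -ᶻ (x -ᶻ z) ≡ 1ℤ +ᶻ (z -ᶻ y)
          alg = solve-∀

  1-2[1+k]≤0 : ∀ (k : ℕ) → 1ℤ -ᶻ + 2 *ᶻ (1ℤ +ᶻ + k) ≤ᶻ 0ℤ
  1-2[1+k]≤0 k = subst (_≤ᶻ 0ℤ) (sym (alg (+ k))) (ZP.neg-≤-pos {suc (k + k)} {0})
    where alg : ∀ x → 1ℤ -ᶻ + 2 *ᶻ (1ℤ +ᶻ x) ≡ -ᶻ (1ℤ +ᶻ (x +ᶻ x))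
          alg = solve-∀

  1≰0 : ¬ (1ℤ ≤ᶻ 0ℤ)
  1≰0 (Z.+≤+ ())

  module _ (w : ℕ → ℕ) (g : SignedPerm w) (a b : ℕ) (1≤a : 1 ≤ a) (a<b : a < b) (b≤n : b ≤ n) where
    open LengthChange w g a b 1≤a a<b b≤n

    -- A quantum edge would have Δ = 1 − 2⟨ρ, β∨⟩ ≤ −1, but an ascent has Δ ≥ 1.
    qbgEdge-ascent⇒Δ≤2 : (up : X < bar Y) → QBGEdge w (b , bar a) → Δ ≤ᶻ + 2
    qbgEdge-ascent⇒Δ≤2 up (inj₁ e) = ZP.≤-trans (ZP.≤-reflexive (trans (cong (λ z → + z -ᶻ + len w) e)
      (trans (cong (_-ᶻ + len w) (ZP.pos-+ 1 (len w))) (cancel (+ len w))))) (Z.+≤+ (s≤s z≤n))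
      where
        cancel : ∀ x → 1ℤ +ᶻ x -ᶻ x ≡ 1ℤ
        cancel = solve-∀
    qbgEdge-ascent⇒Δ≤2 up (inj₂ e) = ⊥-elim (1≰0 (ZP.≤-trans (Ascent.Δ≥1 up) (ZP.≤-trans (ZP.≤-reflexive Δ≡) bound)))
      where
        ρc = ρcoroot (b , bar a)
        Δ≡ : Δ ≡ 1ℤ -ᶻ (+ 2) *ᶻ ρc
        Δ≡ = trans (cong (_-ᶻ + len w) e) (cancel (+ len w) ρc)
          where
            cancel : ∀ x r → x -ᶻ + 2 *ᶻ r +ᶻ 1ℤ -ᶻ x ≡ 1ℤ -ᶻ + 2 *ᶻ r
            cancel = solve-∀
        bound : 1ℤ -ᶻ (+ 2) *ᶻ ρc ≤ᶻ 0ℤ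
        bound rewrite ρcoroot-b+ā a b 1≤a a<b b≤n | sym (+[m∸k]≡+m-+k {bar a} {b} (<⇒≤ (≤-<-trans b≤n n<ā))) = 1-2[1+k]≤0 (bar a ∸ b)

    -- Along a descent, w s_β is an ascent of (w s_β) s_β = w, so the bounds on Δ for w s_β
    -- (between 1 and 1 + 2(n−a) + 2(n−b)) exclude both kinds of edges w → w s_β.
    qbgEdge-not-descent : bar Y < X → ¬ QBGEdge w (b , bar a)
    qbgEdge-not-descent dn = down
      where
        ρc = ρcoroot (b , bar a)
        w′ : ℕ → ℕ
        w′ x = w (sRefl (b , bar a) x)
        module Reflected = LengthChange w′ (SignedPerm-reflect g lb lā) a b 1≤a a<b b≤n
        module ReflectedAscent = Reflected.Ascent (subst₂ _<_ (sym w'a) (sym (trans (cong bar w'b) (bar-bar X≤N))) dn)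
        Δ′≡ : Reflected.Δ ≡ + len w -ᶻ + len w′
        Δ′≡ = cong (λ z → + z -ᶻ + len w′) (len-cong (λ x lx → cong w (Reflection.s-invol lb lā x)))
        down : ¬ QBGEdge w (b , bar a)
        down (inj₁ e) = 1≰0 (ZP.≤-trans ReflectedAscent.Δ≥1 (ZP.≤-trans (ZP.≤-reflexive (trans Δ′≡
          (trans (cong (λ z → + len w -ᶻ + z) e) (cancel (+ len w))))) (ZP.neg-≤-pos {1} {0})))
          where
            cancel : ∀ x → x -ᶻ (1ℤ +ᶻ x) ≡ -ᶻ 1ℤ
            cancel = solve-∀
        down (inj₂ e) = x+2≰x (ZP.≤-trans (ZP.≤-reflexive (sym Δ′≡ub+2)) ReflectedAscent.Δ≤1+2[n-a]+2[n-b])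
          where
            ub = 1ℤ +ᶻ (+ (n ∸ a) +ᶻ + (n ∸ a)) +ᶻ (+ (n ∸ b) +ᶻ + (n ∸ b))
            Δ′≡ub+2 : Reflected.Δ ≡ ub +ᶻ + 2
            Δ′≡ub+2 = begin
                Reflected.Δ ≡⟨ Δ′≡ ⟩
                + len w -ᶻ + len w′ ≡⟨ cong (λ z → + len w -ᶻ z) e ⟩
                + len w -ᶻ (+ len w -ᶻ + 2 *ᶻ ρc +ᶻ 1ℤ) ≡⟨ cong (λ z → + len w -ᶻ (+ len w -ᶻ + 2 *ᶻ z +ᶻ 1ℤ)) (ρcoroot-b+ā a b 1≤a a<b b≤n) ⟩
                + len w -ᶻ (+ len w -ᶻ + 2 *ᶻ (1ℤ +ᶻ (+ bar a -ᶻ + b)) +ᶻ 1ℤ)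
                  ≡⟨ cong (λ z → + len w -ᶻ (+ len w -ᶻ + 2 *ᶻ (1ℤ +ᶻ (z -ᶻ + b)) +ᶻ 1ℤ)) (+[m∸k]≡+m-+k {suc (2 * n)} {a} a≤N) ⟩
                + len w -ᶻ (+ len w -ᶻ + 2 *ᶻ (1ℤ +ᶻ (+ suc (2 * n) -ᶻ + a -ᶻ + b)) +ᶻ 1ℤ)
                  ≡⟨ cong (λ z → + len w -ᶻ (+ len w -ᶻ + 2 *ᶻ (1ℤ +ᶻ (z -ᶻ + a -ᶻ + b)) +ᶻ 1ℤ)) 2n+1≡ ⟩
                + len w -ᶻ (+ len w -ᶻ + 2 *ᶻ (1ℤ +ᶻ ((1ℤ +ᶻ (+ n +ᶻ + n)) -ᶻ + a -ᶻ + b)) +ᶻ 1ℤ) ≡⟨ expand (+ len w) (+ n) (+ a) (+ b) ⟩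
                1ℤ +ᶻ ((+ n -ᶻ + a) +ᶻ (+ n -ᶻ + a)) +ᶻ ((+ n -ᶻ + b) +ᶻ (+ n -ᶻ + b)) +ᶻ + 2
                  ≡⟨ cong₂ (λ u v → 1ℤ +ᶻ (u +ᶻ u) +ᶻ (v +ᶻ v) +ᶻ + 2) (sym (+[m∸k]≡+m-+k a≤n)) (sym (+[m∸k]≡+m-+k b≤n)) ⟩
                ub +ᶻ + 2 ∎
              where
                open ≡-Reasoning
                2n+1≡ : + suc (2 * n) ≡ 1ℤ +ᶻ (+ n +ᶻ + n)
                2n+1≡ = trans (cong (λ z → + suc z) n+n) (trans (ZP.pos-+ 1 (n + n)) (cong (1ℤ +ᶻ_) (ZP.pos-+ n n)))
                expand : ∀ L x y z → L -ᶻ (L -ᶻ + 2 *ᶻ (1ℤ +ᶻ ((1ℤ +ᶻ (x +ᶻ x)) -ᶻ y -ᶻ z)) +ᶻ 1ℤ)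
                                    ≡ 1ℤ +ᶻ ((x -ᶻ y) +ᶻ (x -ᶻ y)) +ᶻ ((x -ᶻ z) +ᶻ (x -ᶻ z)) +ᶻ + 2
                expand = solve-∀
            x+2≰x : ¬ (ub +ᶻ + 2 ≤ᶻ ub)
            x+2≰x h = 2≰0 (ZP.drop‿+≤+ (subst₂ _≤ᶻ_ (cancel ub) (ZP.+-inverseʳ ub) (ZP.+-monoˡ-≤ (-ᶻ ub) h)))
              where
                cancel : ∀ u → u +ᶻ + 2 +ᶻ -ᶻ u ≡ + 2
                cancel = solve-∀
                2≰0 : ¬ (2 ≤ 0)
                2≰0 ()

    qbgEdge⇒cover : QBGEdge w (b , bar a) → BruhatCover w a b
    qbgEdge⇒cover edge with <-cmp X (bar Y)
    ... | tri< up _ _ = up , Ascent.Δ≤2⇒cover up (qbgEdge-ascent⇒Δ≤2 up edge)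
    ... | tri≈ _ e _ = ⊥-elim (X≢Ȳ e)
    ... | tri> _ _ dn = ⊥-elim (qbgEdge-not-descent dn edge)

  N-sort : ∀ z xs → N z (sort xs) ≡ N z xs
  N-sort z xs = sum-↭ (map⁺ (λ x → if x ≡ᵇ z then 1 else 0) (sort-↭ xs))

  +if : ∀ b → + (if b then 1 else 0) ≡ when b 1ℤ
  +if true = refl
  +if false = refl

  +N-map : ∀ z (w : ℕ → ℕ) L → + N z (map w L) ≡ ∑ L (λ x → when (w x ≡ᵇ z) 1ℤ)
  +N-map z w L = trans (cong (λ t → + sum t) (sym (LP.map-∘ {g = λ x → if x ≡ᵇ z then 1 else 0} {f = w} L)))
                   (trans (+sum-map L _) (∑-cong L (λ x _ → +if (w x ≡ᵇ z))))

  -- z lies in sort (map w [1..c]) iff w⁻¹ z ≤ c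
  inPrefix : ∀ {w} → SignedPerm w → ℕ → ℕ → Bool
  inPrefix g c z = SignedPerm.w⁻¹ g z ≤ᵇ c

  module Column {w : ℕ → ℕ} (g : SignedPerm w) where
    open SignedPerm g

    eqb : ∀ {x z} → IsLetter x → IsLetter z → (w x ≡ᵇ z) ≡ (x ≡ᵇ w⁻¹ z)
    eqb {x} {z} lx lz with x ≟ w⁻¹ z
    ... | yes refl rewrite w∘w⁻¹ lz | ≡ᵇ-refl z | ≡ᵇ-refl (w⁻¹ z) = refl
    ... | no ne rewrite ≢⇒≡ᵇf ne = ≢⇒≡ᵇf (λ e → ne (trans (sym (w⁻¹∘w lx)) (cong w⁻¹ e)))

    count-prefix : ∀ c z → c ≤ 2 * n → IsLetter z → + N z (map w (asc 1 c)) ≡ when (inPrefix g c z) 1ℤ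
    count-prefix c z c≤ lz = begin
        + N z (map w (asc 1 c)) ≡⟨ +N-map z w (asc 1 c) ⟩
        ∑ (asc 1 c) (λ x → when (w x ≡ᵇ z) 1ℤ) ≡⟨ cong (λ t → ∑ t (λ x → when (w x ≡ᵇ z) 1ℤ)) (asc≡range 1 c) ⟩
        ∑ (range 1 c) (λ x → when (w x ≡ᵇ z) 1ℤ) ≡⟨ ∑-cong (range 1 c) (λ x m → cong (λ b → when b 1ℤ) (eqb (lx m) lz)) ⟩
        ∑ (range 1 c) (λ x → when (x ≡ᵇ w⁻¹ z) 1ℤ) ≡⟨ fin ⟩
        when (inPrefix g c z) 1ℤ ∎
      where
        open ≡-Reasoning
        lx : ∀ {x} → x ∈ range 1 c → IsLetter x
        lx m = proj₁ (∈-range⁻ m) , ≤-trans (≤-pred (proj₂ (∈-range⁻ m))) c≤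
        fin : ∑ (range 1 c) (λ x → when (x ≡ᵇ w⁻¹ z) 1ℤ) ≡ when (inPrefix g c z) 1ℤ
        fin with w⁻¹ z ≤? c
        ... | yes h rewrite ≤⇒≤ᵇt h = ∑-range-point c 1 (w⁻¹ z) (λ _ → 1ℤ) (proj₁ (w⁻¹-letter lz)) (s≤s h)
        ... | no h rewrite ≰⇒≤ᵇf h = ∑-zero (range 1 c) (λ x m → cong (λ b → when b 1ℤ) (≢⇒≡ᵇf (λ e → h (subst (_≤ c) e (≤-pred (proj₂ (∈-range⁻ m)))))))

    count-column : ∀ c z → c ≤ 2 * n → IsLetter z → + N z (sort (map w (asc 1 c))) ≡ when (inPrefix g c z) 1ℤ
    count-column c z c≤ lz = trans (cong +_ (N-sort z (map w (asc 1 c)))) (count-prefix c z c≤ lz)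

    not-both-complements : ∀ c z → c ≤ n → IsLetter z → (inPrefix g c z ∧ inPrefix g c (bar z)) ≡ false
    not-both-complements c z c≤n lz with w⁻¹ z ≤? c
    ... | no h rewrite ≰⇒≤ᵇf h = refl
    ... | yes h rewrite ≤⇒≤ᵇt h | w⁻¹-bar lz = ≰⇒≤ᵇf (λ h' → <⇒≱ (bar-small (≤-trans h c≤n)) (≤-trans h' c≤n))

  module CoverStep {w : ℕ → ℕ} (g : SignedPerm w) (a b c : ℕ) (1≤a : 1 ≤ a) (a<b : a < b) (b≤c : b ≤ c) (c≤n : c ≤ n) where
    open SignedPerm g
    open LengthChange w g a b 1≤a a<b (≤-trans b≤c c≤n) public
    gS : SignedPerm w'
    gS = SignedPerm-reflect g lb lā

    a≤c : a ≤ c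
    a≤c = ≤-trans (<⇒≤ a<b) b≤c
    c<b̄ : c < bar b
    c<b̄ = ≤-<-trans c≤n n<b̄
    c<ā : c < bar a
    c<ā = ≤-<-trans c≤n n<ā

    classMeets : ℕ → Bool
    classMeets x = (x ≤ᵇ c) ∨ (bar x ≤ᵇ c)

    classMeets-low : ∀ {x} → x ≤ c → classMeets x ≡ true
    classMeets-low {x} h rewrite ≤⇒≤ᵇt h = refl
    classMeets-high : ∀ {x} → IsLetter x → c < x → bar x ≤ c → classMeets x ≡ true
    classMeets-high {x} lx h1 h2 rewrite ≰⇒≤ᵇf (<⇒≱ h1) | ≤⇒≤ᵇt h2 = refl

    classMeets-s : ∀ {p} → IsLetter p → classMeets (s p) ≡ classMeets p
    classMeets-s {p} lp with p ≟ a
    ... | yes refl rewrite s-a = trans (classMeets-high lb̄ c<b̄ (≤-trans (≤-reflexive (bar-bar b≤N)) b≤c)) (sym (classMeets-low a≤c))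
    ... | no pa with p ≟ b
    ... | yes refl rewrite s-b = trans (classMeets-high lā c<ā (≤-trans (≤-reflexive (bar-bar a≤N)) a≤c)) (sym (classMeets-low b≤c))
    ... | no pb with p ≟ bar b
    ... | yes refl rewrite s-b̄ = trans (classMeets-low a≤c) (sym (classMeets-high lb̄ c<b̄ (≤-trans (≤-reflexive (bar-bar b≤N)) b≤c)))
    ... | no pb̄ with p ≟ bar a
    ... | yes refl rewrite s-ā = trans (classMeets-low b≤c) (sym (classMeets-high lā c<ā (≤-trans (≤-reflexive (bar-bar a≤N)) a≤c)))
    ... | no pā rewrite s-o pa pb pb̄ pā = refl

    classes-preserved-step : ∀ {z} → IsLetter z → (inPrefix gS c z ∨ inPrefix gS c (bar z)) ≡ (inPrefix g c z ∨ inPrefix g c (bar z))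
    classes-preserved-step {z} lz rewrite w⁻¹-bar lz | Reflection.s-bar lb lā (w⁻¹-letter lz) = classMeets-s (w⁻¹-letter lz)

    cover-keeps : ∀ {z} → IsLetter z → w a ≢ z → w b ≢ z → T (inPrefix g c z) → T (inPrefix gS c z)
    cover-keeps {z} lz ha hb t with w⁻¹ z ≟ bar b | w⁻¹ z ≟ bar a
    ... | yes e | _ rewrite e | s-b̄ = ≤⇒≤ᵇ a≤c
    ... | no _ | yes e rewrite e | s-ā = ≤⇒≤ᵇ b≤c
    ... | no e1 | no e2 rewrite s-o (λ e → ha (trans (cong w (sym e)) (w∘w⁻¹ lz))) (λ e → hb (trans (cong w (sym e)) (w∘w⁻¹ lz))) e1 e2 = t

    w⁻¹≡bar⇒ : ∀ {z m} → IsLetter z → IsLetter m → w⁻¹ z ≡ bar m → w m ≡ bar z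
    w⁻¹≡bar⇒ {z} {m} lz lm e = begin
        w m ≡⟨ sym (bar-bar (letter≤2n+1 (w-letter lm))) ⟩
        bar (bar (w m)) ≡⟨ cong bar (sym (w-bar lm)) ⟩
        bar (w (bar m)) ≡⟨ cong (λ t → bar (w t)) (sym e) ⟩
        bar (w (w⁻¹ z)) ≡⟨ cong bar (w∘w⁻¹ lz) ⟩
        bar z ∎
      where open ≡-Reasoning

    cover-adds-none : ∀ {z} → IsLetter z → w a ≢ bar z → w b ≢ bar z → T (inPrefix gS c z) → T (inPrefix g c z)
    cover-adds-none {z} lz ha hb t with w⁻¹ z ≟ a | w⁻¹ z ≟ b
    ... | yes e | _ rewrite e | s-a = ⊥-elim (<⇒≱ c<b̄ (≤ᵇ⇒≤ (bar b) c t))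
    ... | no _ | yes e rewrite e | s-b = ⊥-elim (<⇒≱ c<ā (≤ᵇ⇒≤ (bar a) c t))
    ... | no e1 | no e2 rewrite s-o e1 e2 (λ e → hb (w⁻¹≡bar⇒ lz lb e)) (λ e → ha (w⁻¹≡bar⇒ lz la e)) = t

    -- Under a cover step X and Y avoid the letters of P^± (for 1 ≤ p < n given ClassesDiffer), so those
    -- letters are handled by cover-keeps and cover-adds-none.
    module Cover (eo : BruhatCover w a b) where
      up : X < bar Y
      up = proj₁ eo
      xr : T ((X <ᵇ bar X) xor (Y <ᵇ bar Y))
      xr = proj₁ (proj₂ eo)
      nh = proj₂ (proj₂ eo)

      noStraddleAt : ∀ {z} → IsLetter z → c < w⁻¹ z → c < w⁻¹ (bar z) → ¬ (X < z × z < bar Y)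
      noStraddleAt {z} lz h1 h2 (k1 , k2) with w⁻¹ z ≤? n
      ... | yes m≤n = proj₁ (nh (w⁻¹ z) (≤-<-trans b≤c h1) m≤n) (subst (λ t → X < t × t < bar Y) (sym (w∘w⁻¹ lz)) (k1 , k2))
      ... | no m>n = proj₂ (nh (bar (w⁻¹ z)) (subst (b <_) (w⁻¹-bar lz) (≤-<-trans b≤c h2)) (bar-big (≰⇒> m>n)))
                       (subst (λ t → Y < t × t < bar X) (sym ez) (l1 , l2))
        where
          ez : w (bar (w⁻¹ z)) ≡ bar z
          ez = trans (w-bar (w⁻¹-letter lz)) (cong bar (w∘w⁻¹ lz))
          l1 : Y < bar z
          l1 = subst (_< bar z) (bar-bar Y≤N) (bar-anti (m∸n≤m 2n+1 Y) k2)
          l2 : bar z < bar X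
          l2 = bar-anti (letter≤2n+1 lz) k1

      X-inPrefix : T (inPrefix g c X)
      X-inPrefix = subst (λ t → T (t ≤ᵇ c)) (sym (w⁻¹∘w la)) (≤⇒≤ᵇ a≤c)
      Y-inPrefix : T (inPrefix g c Y)
      Y-inPrefix = subst (λ t → T (t ≤ᵇ c)) (sym (w⁻¹∘w lb)) (≤⇒≤ᵇ b≤c)

      c<w⁻¹ : ∀ {z} → inPrefix g c z ≡ false → c < w⁻¹ z
      c<w⁻¹ {z} e = ≰⇒> (λ h → subst T e (≤⇒≤ᵇ h))

      X≢1̄ : X ≢ bar 1
      X≢1̄ e = <⇒≱ up (subst (bar Y ≤_) (sym e) (proj₂ (bar-letter lY)))
      Y≢1̄ : Y ≢ bar 1
      Y≢1̄ e = <⇒≱ up (subst (_≤ X) (sym (trans (cong bar e) (bar-bar {1} (s≤s z≤n)))) (proj₁ lX))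

      X≢n : X ≢ n
      X≢n e with Y ≤? n
      ... | no h = <⇒≱ up (subst (bar Y ≤_) (sym e) (bar-big (≰⇒> h)))
      ... | yes h = subst T (trans (cong₂ _xor_ (trans (x<ᵇx̄≡x≤ᵇn lX) (trans (cong (_≤ᵇ n) e) (≤⇒≤ᵇt {n} {n} ≤-refl))) (trans (x<ᵇx̄≡x≤ᵇn lY) (≤⇒≤ᵇt h)))  refl) xr
      Y≢n : Y ≢ n
      Y≢n e with X ≤? n
      ... | no h = <⇒≱ up (subst (_≤ X) (sym (trans (cong bar e) barn)) (≰⇒> h))
        where barn : bar n ≡ suc n
              barn = trans (cong (λ t → suc (n + t) ∸ n) (+-identityʳ n)) (m+n∸n≡m (suc n) n)
      ... | yes h = subst T (trans (cong₂ _xor_ (trans (x<ᵇx̄≡x≤ᵇn lX) (≤⇒≤ᵇt h)) (trans (x<ᵇx̄≡x≤ᵇn lY) (trans (cong (_≤ᵇ n) e) (≤⇒≤ᵇt {n} {n} ≤-refl)))) refl) xr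

      module CoverAt (p : ℕ) (1≤p : 1 ≤ p) (p<n : p < n)
                 (U1 : ((inPrefix g c p ∨ inPrefix g c (bar p)) xor (inPrefix g c (suc p) ∨ inPrefix g c (bar (suc p)))) ≡ true) where
        lp : IsLetter p
        lp = 1≤p , ≤-trans (<⇒≤ p<n) n≤2n
        lp1 : IsLetter (suc p)
        lp1 = s≤s z≤n , ≤-trans p<n n≤2n
        bsp : bar p ≡ suc (bar (suc p))
        bsp = +-∸-assoc 1 (letter≤2n+1 lp1)
        bq<bp : bar (suc p) < bar p
        bq<bp = subst (bar (suc p) <_) (sym bsp) ≤-refl

        no-p+1-class : inPrefix g c p ≡ true → (inPrefix g c (suc p) ≡ false) × (inPrefix g c (bar (suc p)) ≡ false)
        no-p+1-class e with xor≡true⁻ U1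
        ... | inj₁ (_ , e2) = ∨-false⁻ e2
        ... | inj₂ (e1 , _) = ⊥-elim (true≢false (trans (sym (∨-trueˡ {y = inPrefix g c (bar p)} e)) e1))
        no-p-class : inPrefix g c (bar (suc p)) ≡ true → (inPrefix g c p ≡ false) × (inPrefix g c (bar p) ≡ false)
        no-p-class e with xor≡true⁻ U1
        ... | inj₂ (e1 , _) = ∨-false⁻ e1
        ... | inj₁ (_ , e2) = ⊥-elim (true≢false (trans (sym (∨-trueʳ {x = inPrefix g c (suc p)} e)) e2))

        c<w⁻¹-bar-bar : ∀ {z} → IsLetter z → c < w⁻¹ z → c < w⁻¹ (bar (bar z))
        c<w⁻¹-bar-bar lz h = subst (λ t → c < w⁻¹ t) (sym (bar-bar (letter≤2n+1 lz))) h

        X≢p : X ≢ p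
        X≢p e = ⊥-elim (subst T (proj₂ nq) (subst (λ t → T (inPrefix g c t)) Yq Y-inPrefix))
          where
            nq = no-p+1-class (T⇒≡true (subst (λ t → T (inPrefix g c t)) e X-inPrefix))
            nh' = noStraddleAt lp1 (c<w⁻¹ (proj₁ nq)) (c<w⁻¹ (proj₂ nq))
            Ȳ≤ : bar Y ≤ suc p
            Ȳ≤ = ≮⇒≥ (λ h → nh' (subst (_< suc p) (sym e) ≤-refl , h))
            Ȳ≡ : bar Y ≡ suc p
            Ȳ≡ = ≤-antisym Ȳ≤ (subst (_< bar Y) e up)
            Yq : Y ≡ bar (suc p)
            Yq = trans (sym (bar-bar Y≤N)) (cong bar Ȳ≡)

        X≢[p+1]‾ : X ≢ bar (suc p)
        X≢[p+1]‾ e = ⊥-elim (subst T (proj₁ np) (subst (λ t → T (inPrefix g c t)) Yp Y-inPrefix))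
          where
            np = no-p-class (T⇒≡true (subst (λ t → T (inPrefix g c t)) e X-inPrefix))
            nh' = noStraddleAt (bar-letter lp) (c<w⁻¹ (proj₂ np)) (c<w⁻¹-bar-bar lp (c<w⁻¹ (proj₁ np)))
            Ȳ≤ : bar Y ≤ bar p
            Ȳ≤ = ≮⇒≥ (λ h → nh' (subst (_< bar p) (sym e) bq<bp , h))
            Ȳ≡ : bar Y ≡ bar p
            Ȳ≡ = ≤-antisym Ȳ≤ (subst (_≤ bar Y) (sym bsp) (subst (_< bar Y) e up))
            Yp : Y ≡ p
            Yp = trans (sym (bar-bar Y≤N)) (trans (cong bar Ȳ≡) (bar-bar (letter≤2n+1 lp)))

        Y≢p : Y ≢ p
        Y≢p e = <⇒≱ up (subst (_≤ X) (sym (trans (cong bar e) refl)) (subst (_≤ X) (sym bsp) bq<X))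
          where
            nq = no-p+1-class (T⇒≡true (subst (λ t → T (inPrefix g c t)) e Y-inPrefix))
            nh' = noStraddleAt (bar-letter lp1) (c<w⁻¹ (proj₂ nq)) (c<w⁻¹-bar-bar lp1 (c<w⁻¹ (proj₁ nq)))
            bq≤X : bar (suc p) ≤ X
            bq≤X = ≮⇒≥ (λ h → nh' (h , subst (bar (suc p) <_) (cong bar (sym e)) bq<bp))
            bq<X : bar (suc p) < X
            bq<X = ≤∧≢⇒< bq≤X (λ e' → subst T (proj₂ nq) (subst (λ t → T (inPrefix g c t)) (sym e') X-inPrefix))

        Y≢[p+1]‾ : Y ≢ bar (suc p)
        Y≢[p+1]‾ e = <⇒≱ (≤∧≢⇒< p≤X (λ e' → subst T (proj₁ np) (subst (λ t → T (inPrefix g c t)) (sym e') X-inPrefix))) (≤-pred X<sp)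
          where
            np = no-p-class (T⇒≡true (subst (λ t → T (inPrefix g c t)) e Y-inPrefix))
            nh' = noStraddleAt lp (c<w⁻¹ (proj₁ np)) (c<w⁻¹ (proj₂ np))
            Ȳ≡ : bar Y ≡ suc p
            Ȳ≡ = trans (cong bar e) (bar-bar (letter≤2n+1 lp1))
            X<sp : X < suc p
            X<sp = subst (X <_) Ȳ≡ up
            p≤X : p ≤ X
            p≤X = ≮⇒≥ (λ h → nh' (h , subst (p <_) (sym Ȳ≡) ≤-refl))

  ∈-asc⁻ : ∀ {x a b} → x ∈ asc a b → a ≤ x × x ≤ b
  ∈-asc⁻ {x} {a} {b} m with ∈-range⁻ (subst (x ∈_) (asc≡range a b) m)
  ... | h1 , h2 with a ≤? suc b
  ...   | yes h = h1 , ≤-pred (subst (x <_) (m+[n∸m]≡n h) h2)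
  ...   | no h = ⊥-elim (<⇒≱ h2 (≤-trans (≤-reflexive (trans (cong (λ zz → a + zz) (m≤n⇒m∸n≡0 (<⇒≤ (≰⇒> h)))) (+-identityʳ a))) h1))
    where open import Data.Nat using (_≤?_)

  ∈-desc⁻ : ∀ {x a b} → x ∈ desc a b → b ≤ x × x ≤ a
  ∈-desc⁻ m = ∈-asc⁻ (reverse⁻ m)

  InΓr : ℕ → Root → Set
  InΓr c β = Σ[ i ∈ ℕ ] Σ[ j ∈ ℕ ] (β ≡ (i , bar j)) × 1 ≤ j × j < i × i ≤ c

  ∈Γr : ∀ {c β} → β ∈ Γr c → InΓr c β
  ∈Γr {c} {β} m with ∈-concat⁻′ (map Γi (desc c 2)) m
  ... | xs , β∈xs , xs∈ with ∈-map⁻ Γi xs∈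
  ...   | i , i∈ , refl with ∈-map⁻ (λ j → (i , bar j)) β∈xs
  ...     | j , j∈ , refl = i , j , refl , proj₁ dj ,
             ≤-trans (s≤s (proj₂ dj)) (≤-reflexive (m+[n∸m]≡n {1} {i} (≤-trans (s≤s z≤n) (proj₁ di)))) ,
             proj₂ di
    where
      dj = ∈-desc⁻ {j} {i ∸ 1} {1} j∈
      di = ∈-desc⁻ {i} {c} {2} i∈

  Γr-letterRoot : ∀ {c β} → c ≤ n → β ∈ Γr c → IsLetterRoot β
  Γr-letterRoot {c} c≤n m with ∈Γr {c} m
  ... | i , j , refl , 1≤j , j<i , i≤c =
        letter (≤-trans 1≤j (<⇒≤ j<i)) (≤-trans i≤c c≤n) , bar-letter (letter 1≤j (≤-trans (<⇒≤ j<i) (≤-trans i≤c c≤n)))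

  Γl-letterRoot : ∀ {k β} → k ≤ n → β ∈ Γl k → IsLetterRoot β
  Γl-letterRoot {k} {β} k≤n m with ∈-concat⁻′ (map (Γki k) (desc k 1)) m
  ... | xs , β∈xs , xs∈ with ∈-map⁻ (Γki k) xs∈
  ...   | i , i∈ , refl = go β∈xs
    where
      di = ∈-desc⁻ {i} {k} {1} i∈
      li : IsLetter i
      li = letter (proj₁ di) (≤-trans (proj₂ di) k≤n)
      go : β ∈ Γki k i → IsLetterRoot β
      go m' with ∈-++⁻ (map (λ j → (i , j)) (asc (suc k) n)) m'
      ... | inj₁ m1 with ∈-map⁻ (λ j → (i , j)) m1
      ...   | j , j∈ , refl = li , letter (≤-trans (s≤s z≤n) (proj₁ (∈-asc⁻ j∈))) (proj₂ (∈-asc⁻ j∈))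
      go m' | inj₂ (here refl) = li , bar-letter li
      go m' | inj₂ (there m2) with ∈-++⁻ (map (λ j → (i , bar j)) (desc n (suc k))) m2
      ... | inj₁ m3 with ∈-map⁻ (λ j → (i , bar j)) m3
      ...   | j , j∈ , refl = li , bar-letter (letter (≤-trans (s≤s z≤n) (proj₁ dj)) (proj₂ dj))
        where dj = ∈-desc⁻ {j} {n} {suc k} j∈
      go m' | inj₂ (there m2) | inj₂ m4 with ∈-map⁻ (λ j → (i , bar j)) m4
      ...   | j , j∈ , refl = li , bar-letter (letter (proj₁ dj) (≤-trans (proj₂ dj) (≤-trans (m∸n≤m i 1) (≤-trans (proj₂ di) k≤n))))
        where dj = ∈-desc⁻ {j} {i ∸ 1} {1} j∈

  ∈-selected⁻ : ∀ (B : List Root) bs {β} → β ∈ selected (zip B bs) → β ∈ B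
  ∈-selected⁻ [] bs ()
  ∈-selected⁻ (x ∷ B) [] ()
  ∈-selected⁻ (x ∷ B) (true ∷ bs) (here refl) = here refl
  ∈-selected⁻ (x ∷ B) (true ∷ bs) (there m) = there (∈-selected⁻ B bs m)
  ∈-selected⁻ (x ∷ B) (false ∷ bs) m = there (∈-selected⁻ B bs m)

  selected-++ : ∀ (xs ys : List (Root × Bool)) → selected (xs ++ ys) ≡ selected xs ++ selected ys
  selected-++ [] ys = refl
  selected-++ ((β , true) ∷ xs) ys = cong (β ∷_) (selected-++ xs ys)
  selected-++ ((β , false) ∷ xs) ys = selected-++ xs ys

  chunks-zip : ∀ (βss : List (List Root)) (bs : List Bool) → chunks (map length βss) (zip (concat βss) bs) ≡ zipChunks βss bs
  chunks-zip [] bs = refl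
  chunks-zip (βs ∷ βss) bs = cong₂ _∷_ (take-zip-++ βs (concat βss) bs)
    (trans (cong (chunks (map length βss)) (drop-zip-++ βs (concat βss) bs)) (chunks-zip βss (drop (length βs) bs)))

  Path-++ : ∀ w (xs ys : List Root) → Path w (xs ++ ys) → Path w xs × Path (mult w xs) ys
  Path-++ w [] ys p = _ , p
  Path-++ w (β ∷ xs) ys (e , p) with Path-++ (λ x → w (sRefl β x)) xs ys p
  ... | p1 , p2 = (e , p1) , p2

  blocksOf : List ℕ → List (List Root)
  blocksOf cs = concat (map (λ c → Γl c ∷ Γr c ∷ []) cs)
  blockSizesOf : List ℕ → List ℕ
  blockSizesOf cs = concat (map (λ c → c ∷ c ∷ []) cs)

  cols : (ℕ → ℕ) → List ℕ → List Bool → List (List ℕ)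
  cols w cs bs = colsGo w (blockSizesOf cs) (map selected (zipChunks (blocksOf cs) bs))

  BlockInfo : List ℕ → List ℕ → ℕ → Set
  BlockInfo C D c = Σ[ w0 ∈ (ℕ → ℕ) ] Σ[ g0 ∈ SignedPerm w0 ] Σ[ βs ∈ List Root ]
    (C ≡ sort (map w0 (asc 1 c))) × (D ≡ sort (map (mult w0 βs) (asc 1 c))) × Path w0 βs × (∀ β → β ∈ βs → InΓr c β)

  blockStructure : ∀ cs bs w → SignedPerm w → (∀ c → c ∈ cs → c ≤ n) → Path w (selected (zip (concat (blocksOf cs)) bs)) →
    ∀ i → i < length cs → Σ[ c ∈ ℕ ] (c ∈ cs) × BlockInfo (colAt (cols w cs bs) (suc (2 * i))) (colAt (cols w cs bs) (suc (suc (2 * i)))) c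
  blockStructure [] bs w g hc p i ()
  blockStructure (c ∷ cs) bs w g hc p i i< = res i i<
    where
      l1 = length (Γl c)
      l2 = length (Γr c)
      R = concat (blocksOf cs)
      bs1 = take l1 bs
      r1 = drop l1 bs
      bs2 = take l2 r1
      r2 = drop l2 r1
      T1 = selected (zip (Γl c) bs1)
      T2 = selected (zip (Γr c) bs2)
      Tr = selected (zip R r2)
      eqz : selected (zip (Γl c ++ (Γr c ++ R)) bs) ≡ T1 ++ (T2 ++ Tr)
      eqz = trans (cong selected (zip-++ (Γl c) (Γr c ++ R) bs))
             (trans (selected-++ (zip (Γl c) bs1) _)
               (cong (T1 ++_) (trans (cong selected (zip-++ (Γr c) R r1)) (selected-++ (zip (Γr c) bs2) _))))
      p' = subst (Path w) eqz p
      pA = Path-++ w T1 (T2 ++ Tr) p'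
      pB = Path-++ (mult w T1) T2 Tr (proj₂ pA)
      c≤n = hc c (here refl)
      g1 : SignedPerm (mult w T1)
      g1 = SignedPerm-mult T1 g (tabulate (λ m → Γl-letterRoot c≤n (∈-selected⁻ (Γl c) bs1 m)))
      g2 : SignedPerm (mult (mult w T1) T2)
      g2 = SignedPerm-mult T2 g1 (tabulate (λ m → Γr-letterRoot c≤n (∈-selected⁻ (Γr c) bs2 m)))
      res : ∀ i → i < suc (length cs) → Σ[ c' ∈ ℕ ] (c' ∈ c ∷ cs) × BlockInfo (colAt (cols w (c ∷ cs) bs) (suc (2 * i))) (colAt (cols w (c ∷ cs) bs) (suc (suc (2 * i)))) c'
      res zero _ = c , here refl , mult w T1 , g1 , T2 , refl , refl , proj₁ pB , (λ β m → ∈Γr (∈-selected⁻ (Γr c) bs2 m))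
      res (suc i) (s≤s i<) with blockStructure cs r2 (mult (mult w T1) T2) g2 (λ c' m → hc c' (there m)) (proj₂ pB) i i<
      ... | c' , m , bi rewrite 2*[1+i]≡2+2*i i = c' , there m , bi

  -- P⁺ and P⁻ along the Γ_r-part of a block

  -- For 1 ≤ p < n: exactly one of the classes {p, p̄}, {p+1, (p+1)‾} meets the column; vacuous for p ∈ {0, n}.
  ClassesDiffer : ℕ → (ℕ → Bool) → Bool
  ClassesDiffer zero u = true
  ClassesDiffer (suc k) u = if suc k ≡ᵇ n then true else (u (suc k) ∨ u (bar (suc k))) xor (u (suc (suc k)) ∨ u (bar (suc (suc k))))

  ClassesPreserved : ∀ {w w'} → SignedPerm w → SignedPerm w' → ℕ → Set
  ClassesPreserved g g' c = ∀ z → IsLetter z → (inPrefix g' c z ∨ inPrefix g' c (bar z)) ≡ (inPrefix g c z ∨ inPrefix g c (bar z))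

  PlusMinusMonotone : ∀ {w w'} → SignedPerm w → SignedPerm w' → ℕ → ℕ → Set
  PlusMinusMonotone g g' c p = (∀ z → z ∈ Pplus p → T (inPrefix g c z) → T (inPrefix g' c z)) × (∀ z → z ∈ Pminus p → T (inPrefix g' c z) → T (inPrefix g c z))

  ClassesDiffer-preserved : ∀ {w w'} (g : SignedPerm w) (g' : SignedPerm w') c p → p ≤ n → ClassesPreserved g g' c → ClassesDiffer p (inPrefix g' c) ≡ ClassesDiffer p (inPrefix g c)
  ClassesDiffer-preserved g g' c zero _ inv = refl
  ClassesDiffer-preserved g g' c (suc k) p≤n inv with suc k ≡ᵇ n in e
  ... | true = refl
  ... | false = cong₂ _xor_ (inv (suc k) (s≤s z≤n , ≤-trans p≤n n≤2n))
                           (inv (suc (suc k)) (s≤s z≤n , ≤-trans (≤∧≢⇒< p≤n (≡ᵇf⇒≢ e)) n≤2n))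

  data PlusLetter (p z : ℕ) : Set where
    pc0 : p ≡ 0 → z ≡ bar 1 → PlusLetter p z
    pcn : p ≡ n → z ≡ n → PlusLetter p z
    pcm1 : 1 ≤ p → p < n → z ≡ p → PlusLetter p z
    pcm2 : 1 ≤ p → p < n → z ≡ bar (suc p) → PlusLetter p z

  data MinusLetter (p z : ℕ) : Set where
    mc0 : p ≡ 0 → z ≡ 1 → MinusLetter p z
    mcn : p ≡ n → z ≡ bar n → MinusLetter p z
    mcm1 : 1 ≤ p → p < n → z ≡ suc p → MinusLetter p z
    mcm2 : 1 ≤ p → p < n → z ≡ bar p → MinusLetter p z

  Pplus-cases : ∀ p z → p ≤ n → z ∈ Pplus p → PlusLetter p z
  Pplus-cases zero z _ (here refl) = pc0 refl refl
  Pplus-cases (suc k) z p≤n m = go (suc k ≡ᵇ n) refl m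
    where
      go : ∀ b → (suc k ≡ᵇ n) ≡ b → z ∈ (if b then n ∷ [] else suc k ∷ bar (suc (suc k)) ∷ []) → PlusLetter (suc k) z
      go true e (here refl) = pcn (≡ᵇ⇒ e) refl
      go false e (here refl) = pcm1 (s≤s z≤n) (≤∧≢⇒< p≤n (≡ᵇf⇒≢ e)) refl
      go false e (there (here refl)) = pcm2 (s≤s z≤n) (≤∧≢⇒< p≤n (≡ᵇf⇒≢ e)) refl
  Pminus-cases : ∀ p z → p ≤ n → z ∈ Pminus p → MinusLetter p z
  Pminus-cases zero z _ (here refl) = mc0 refl refl
  Pminus-cases (suc k) z p≤n m = go (suc k ≡ᵇ n) refl m
    where
      go : ∀ b → (suc k ≡ᵇ n) ≡ b → z ∈ (if b then bar n ∷ [] else suc (suc k) ∷ bar (suc k) ∷ []) → MinusLetter (suc k) z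
      go true e (here refl) = mcn (≡ᵇ⇒ e) refl
      go false e (here refl) = mcm1 (s≤s z≤n) (≤∧≢⇒< p≤n (≡ᵇf⇒≢ e)) refl
      go false e (there (here refl)) = mcm2 (s≤s z≤n) (≤∧≢⇒< p≤n (≡ᵇf⇒≢ e)) refl

  ClassesDiffer-mid : ∀ p (u : ℕ → Bool) → 1 ≤ p → p < n → ClassesDiffer p u ≡ (u p ∨ u (bar p)) xor (u (suc p) ∨ u (bar (suc p)))
  ClassesDiffer-mid (suc k) u _ p<n rewrite ≢⇒≡ᵇf {suc k} {n} (<⇒≢ p<n) = refl

  cover-monotone : ∀ {w} (g : SignedPerm w) a b c (1≤a : 1 ≤ a) (a<b : a < b) (b≤c : b ≤ c) (c≤n : c ≤ n) → BruhatCover w a b →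
            ∀ p → p ≤ n → T (ClassesDiffer p (inPrefix g c)) → PlusMinusMonotone g (CoverStep.gS g a b c 1≤a a<b b≤c c≤n) c p
  cover-monotone {w} g a b c 1≤a a<b b≤c c≤n eo p p≤n cnd = mon1 , mon2
    where
      open CoverStep g a b c 1≤a a<b b≤c c≤n
      open Cover eo
      U1 : 1 ≤ p → p < n → ((inPrefix g c p ∨ inPrefix g c (bar p)) xor (inPrefix g c (suc p) ∨ inPrefix g c (bar (suc p)))) ≡ true
      U1 h1 h2 = trans (sym (ClassesDiffer-mid p (inPrefix g c) h1 h2)) (T⇒≡true cnd)
      n≥1 : 1 ≤ n
      n≥1 = ≤-trans 1≤a (≤-trans (<⇒≤ a<b) (≤-trans b≤c c≤n))
      mon1 : ∀ z → z ∈ Pplus p → T (inPrefix g c z) → T (inPrefix gS c z)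
      mon1 z m t with Pplus-cases p z p≤n m
      ... | pc0 refl refl = cover-keeps (bar-letter (letter (s≤s z≤n) n≥1)) X≢1̄ Y≢1̄ t
      ... | pcn refl refl = cover-keeps (letter n≥1 ≤-refl) X≢n Y≢n t
      ... | pcm1 h1 h2 refl = cover-keeps (letter h1 (<⇒≤ h2)) (CoverAt.X≢p p h1 h2 (U1 h1 h2)) (CoverAt.Y≢p p h1 h2 (U1 h1 h2)) t
      ... | pcm2 h1 h2 refl = cover-keeps (bar-letter (letter (s≤s z≤n) h2)) (CoverAt.X≢[p+1]‾ p h1 h2 (U1 h1 h2)) (CoverAt.Y≢[p+1]‾ p h1 h2 (U1 h1 h2)) t
      mon2 : ∀ z → z ∈ Pminus p → T (inPrefix gS c z) → T (inPrefix g c z)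
      mon2 z m t with Pminus-cases p z p≤n m
      ... | mc0 refl refl = cover-adds-none (letter (s≤s z≤n) n≥1) X≢1̄ Y≢1̄ t
      ... | mcn refl refl = cover-adds-none (bar-letter (letter n≥1 ≤-refl)) (subst (X ≢_) (sym (bar-bar {n} (letter≤2n+1 (letter n≥1 ≤-refl)))) X≢n) (subst (Y ≢_) (sym (bar-bar {n} (letter≤2n+1 (letter n≥1 ≤-refl)))) Y≢n) t
      ... | mcm1 h1 h2 refl = cover-adds-none (letter (s≤s z≤n) h2) (CoverAt.X≢[p+1]‾ p h1 h2 (U1 h1 h2)) (CoverAt.Y≢[p+1]‾ p h1 h2 (U1 h1 h2)) t
      ... | mcm2 h1 h2 refl = cover-adds-none (bar-letter (letter h1 (<⇒≤ h2))) (subst (X ≢_) (sym (bar-bar {p} (letter≤2n+1 (letter h1 (<⇒≤ h2))))) (CoverAt.X≢p p h1 h2 (U1 h1 h2))) (subst (Y ≢_) (sym (bar-bar {p} (letter≤2n+1 (letter h1 (<⇒≤ h2))))) (CoverAt.Y≢p p h1 h2 (U1 h1 h2))) t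

  pathΓr-monotone : ∀ c p → c ≤ n → p ≤ n → ∀ Ts {w} (g : SignedPerm w) → (∀ β → β ∈ Ts → InΓr c β) → Path w Ts →
    Σ[ gT ∈ SignedPerm (mult w Ts) ] ClassesPreserved g gT c × (T (ClassesDiffer p (inPrefix g c)) → PlusMinusMonotone g gT c p)
  pathΓr-monotone c p c≤n p≤n [] g hT _ = g , (λ z _ → refl) , (λ _ → (λ z m t → t) , (λ z m t → t))
  pathΓr-monotone c p c≤n p≤n (β ∷ Ts) {w} g hT (e , rest) with hT β (here refl)
  ... | i , j , refl , 1≤j , j<i , i≤c with pathΓr-monotone c p c≤n p≤n Ts gS (λ β m → hT β (there m)) rest
    where gS = CoverStep.gS g j i c 1≤j j<i i≤c c≤n
  ... | gT , classes-C≡D , monT = gT , inv , mon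
    where
      gS = CoverStep.gS g j i c 1≤j j<i i≤c c≤n
      eo = qbgEdge⇒cover w g j i 1≤j j<i (≤-trans i≤c c≤n) e
      invS : ClassesPreserved g gS c
      invS z lz = CoverStep.classes-preserved-step g j i c 1≤j j<i i≤c c≤n lz
      inv : ClassesPreserved g gT c
      inv z lz = trans (classes-C≡D z lz) (invS z lz)
      mon : T (ClassesDiffer p (inPrefix g c)) → PlusMinusMonotone g gT c p
      mon cnd = (λ z m t → proj₁ m2 z m (proj₁ m1 z m t)) , (λ z m t → proj₂ m1 z m (proj₂ m2 z m t))
        where
          m1 = cover-monotone g j i c 1≤j j<i i≤c c≤n eo p p≤n cnd
          m2 = monT (subst T (sym (ClassesDiffer-preserved g gS c p p≤n invS)) cnd)

  -- Peaks of h on a split column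

  PeakConclusion : ℕ → List ℕ → List ℕ → Set
  PeakConclusion p C D = ∃ λ x → x ∈ Pplus p × x ∈ C × x ∈ D
        × (∀ y → y ∈ Pplus p → y ∈ C → y ≡ x)
        × (∀ y → y ∈ Pplus p → y ∈ D → y ≡ x)
        × (∀ y → y ∈ Pminus p → y ∉ C)
        × (∀ y → y ∈ Pminus p → y ∉ D)

  PeakProperty : ℕ → List ℕ → List ℕ → Set
  PeakProperty p C D = (pair2 p C ≡ + 1 → ¬ (pair2 p D ≤ᶻ 0ℤ)) × (pair2 p D ≡ + 1 → ¬ (pair2 p C +ᶻ 1ℤ ≤ᶻ 0ℤ) → PeakConclusion p C D)

  N≥1⇒∈ : ∀ z τ → 1 ≤ N z τ → z ∈ τ
  N≥1⇒∈ z [] ()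
  N≥1⇒∈ z (x ∷ τ) h with x ≟ z
  ... | yes refl = here refl
  ... | no ne rewrite ≢⇒≡ᵇf ne = there (N≥1⇒∈ z τ h)

  ∈⇒N≥1 : ∀ z τ → z ∈ τ → 1 ≤ N z τ
  ∈⇒N≥1 z (x ∷ τ) (here refl) rewrite ≡ᵇ-refl z = s≤s z≤n
  ∈⇒N≥1 z (x ∷ τ) (there m) = ≤-trans (∈⇒N≥1 z τ m) (m≤n+m _ _)

  count⇒∈ : ∀ {z τ b} → + N z τ ≡ when b 1ℤ → T b → z ∈ τ
  count⇒∈ {z} {τ} {true} e _ = N≥1⇒∈ z τ (ZP.drop‿+≤+ (subst (1ℤ ≤ᶻ_) (sym e) ZP.≤-refl))
  count⇒∉ : ∀ {z τ b} → + N z τ ≡ when b 1ℤ → b ≡ false → z ∉ τ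
  count⇒∉ {z} {τ} {false} e _ m = <⇒≱ (∈⇒N≥1 z τ m) (≤-reflexive (ZP.+-injective e))

  peakConclusion-single : ∀ p C D (l1 l2 : ℕ) {u1 u2 v1 v2 : Bool} → Pplus p ≡ l1 ∷ [] → Pminus p ≡ l2 ∷ [] →
    + N l1 C ≡ when u1 1ℤ → + N l2 C ≡ when u2 1ℤ → + N l1 D ≡ when v1 1ℤ → + N l2 D ≡ when v2 1ℤ →
    T (u1 ∧ v1 ∧ not u2 ∧ not v2) → PeakConclusion p C D
  peakConclusion-single p C D l1 l2 {u1} {u2} {v1} {v2} ep em c1 c2 d1 d2 t rewrite ep | em =
    l1 , here refl , count⇒∈ c1 t1 , count⇒∈ d1 t2 ,
    (λ { y (here refl) _ → refl }) , (λ { y (here refl) _ → refl }) ,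
    (λ { y (here refl) → count⇒∉ c2 (T-not⁻ t3) }) , (λ { y (here refl) → count⇒∉ d2 (T-not⁻ t4) })
    where
      t1 = T-∧ˡ t
      t2 = T-∧ˡ (T-∧ʳ {u1} t)
      t3 = T-∧ˡ (T-∧ʳ {v1} (T-∧ʳ {u1} t))
      t4 = T-∧ʳ {not u2} (T-∧ʳ {v1} (T-∧ʳ {u1} t))

  peakConclusion-pair : ∀ p C D (l1 l2 l3 l4 : ℕ) {u1 u2 u3 u4 v1 v2 v3 v4 : Bool} → Pplus p ≡ l1 ∷ l4 ∷ [] → Pminus p ≡ l3 ∷ l2 ∷ [] →
    + N l1 C ≡ when u1 1ℤ → + N l2 C ≡ when u2 1ℤ → + N l3 C ≡ when u3 1ℤ → + N l4 C ≡ when u4 1ℤ →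
    + N l1 D ≡ when v1 1ℤ → + N l2 D ≡ when v2 1ℤ → + N l3 D ≡ when v3 1ℤ → + N l4 D ≡ when v4 1ℤ →
    T (plusWitnessMid u1 u2 u3 u4 v1 v2 v3 v4) → PeakConclusion p C D
  peakConclusion-pair p C D l1 l2 l3 l4 {u1} {u2} {u3} {u4} {v1} {v2} {v3} {v4} ep em c1 c2 c3 c4 d1 d2 d3 d4 t rewrite ep | em with T-∨⁻ t
  ... | inj₁ r = l1 , here refl , count⇒∈ c1 (T-∧ˡ r) , count⇒∈ d1 (T-∧ˡ r2) ,
          (λ { y (here refl) _ → refl ; y (there (here refl)) m → ⊥-elim (count⇒∉ c4 (T-not⁻ (T-∧ˡ r3)) m) }) ,
          (λ { y (here refl) _ → refl ; y (there (here refl)) m → ⊥-elim (count⇒∉ d4 (T-not⁻ (T-∧ˡ r4)) m) }) ,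
          (λ { y (here refl) → count⇒∉ c3 (T-not⁻ (T-∧ˡ r7)) ; y (there (here refl)) → count⇒∉ c2 (T-not⁻ (T-∧ˡ r6)) }) ,
          (λ { y (here refl) → count⇒∉ d3 (T-not⁻ r9) ; y (there (here refl)) → count⇒∉ d2 (T-not⁻ (T-∧ˡ r8)) })
    where
      r2 = T-∧ʳ {u1} r
      r3 = T-∧ʳ {v1} r2
      r4 = T-∧ʳ {not u4} r3
      r6 = T-∧ʳ {not v4} r4
      r7 = T-∧ʳ {not u2} r6
      r8 = T-∧ʳ {not u3} r7
      r9 = T-∧ʳ {not v2} r8
  ... | inj₂ r = l4 , there (here refl) , count⇒∈ c4 (T-∧ˡ r) , count⇒∈ d4 (T-∧ˡ r2) ,
          (λ { y (here refl) m → ⊥-elim (count⇒∉ c1 (T-not⁻ (T-∧ˡ r3)) m) ; y (there (here refl)) _ → refl }) ,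
          (λ { y (here refl) m → ⊥-elim (count⇒∉ d1 (T-not⁻ (T-∧ˡ r4)) m) ; y (there (here refl)) _ → refl }) ,
          (λ { y (here refl) → count⇒∉ c3 (T-not⁻ (T-∧ˡ r7)) ; y (there (here refl)) → count⇒∉ c2 (T-not⁻ (T-∧ˡ r6)) }) ,
          (λ { y (here refl) → count⇒∉ d3 (T-not⁻ r9) ; y (there (here refl)) → count⇒∉ d2 (T-not⁻ (T-∧ˡ r8)) })
    where
      r2 = T-∧ʳ {u4} r
      r3 = T-∧ʳ {v4} r2
      r4 = T-∧ʳ {not u1} r3
      r6 = T-∧ʳ {not v1} r4
      r7 = T-∧ʳ {not u2} r6
      r8 = T-∧ʳ {not u3} r7
      r9 = T-∧ʳ {not v2} r8

  ≡⇒≡ᵇt : ∀ {x y} → x ≡ y → (x ≡ᵇ y) ≡ true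
  ≡⇒≡ᵇt {x} refl = ≡ᵇ-refl x

  pair2-n : ∀ k τ → suc k ≡ n → pair2 (suc k) τ ≡ + N n τ -ᶻ + N (bar n) τ
  pair2-n k τ e rewrite ≡⇒≡ᵇt e = refl
  pair2-m : ∀ k τ → suc k ≢ n → pair2 (suc k) τ ≡ (+ N (suc k) τ -ᶻ + N (bar (suc k)) τ) -ᶻ (+ N (suc (suc k)) τ -ᶻ + N (bar (suc (suc k))) τ)
  pair2-m k τ ne rewrite ≢⇒≡ᵇf ne = refl
  Pplus-n : ∀ k → suc k ≡ n → Pplus (suc k) ≡ n ∷ []
  Pplus-n k e rewrite ≡⇒≡ᵇt e = refl
  Pminus-n : ∀ k → suc k ≡ n → Pminus (suc k) ≡ bar n ∷ []
  Pminus-n k e rewrite ≡⇒≡ᵇt e = refl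
  Pplus-m : ∀ k → suc k ≢ n → Pplus (suc k) ≡ suc k ∷ bar (suc (suc k)) ∷ []
  Pplus-m k ne rewrite ≢⇒≡ᵇf ne = refl
  Pminus-m : ∀ k → suc k ≢ n → Pminus (suc k) ≡ suc (suc k) ∷ bar (suc k) ∷ []
  Pminus-m k ne rewrite ≢⇒≡ᵇf ne = refl
  ClassesDiffer-n : ∀ k (u : ℕ → Bool) → suc k ≡ n → ClassesDiffer (suc k) u ≡ true
  ClassesDiffer-n k u e rewrite ≡⇒≡ᵇt e = refl

  module BlockPeak (p c : ℕ) (n≥1 : 1 ≤ n) (p≤n : p ≤ n) (c≤n : c ≤ n) {w0 : ℕ → ℕ} (g0 : SignedPerm w0) (Ts : List Root)
            (roots : ∀ β → β ∈ Ts → InΓr c β) (path : Path w0 Ts) where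
    pm = pathΓr-monotone c p c≤n p≤n Ts g0 roots path
    gT = proj₁ pm
    inv = proj₁ (proj₂ pm)
    mon = proj₂ (proj₂ pm)
    c≤2n : c ≤ 2 * n
    c≤2n = ≤-trans c≤n n≤2n
    uC = inPrefix g0 c
    uD = inPrefix gT c
    Cc = sort (map w0 (asc 1 c))
    Dc = sort (map (mult w0 Ts) (asc 1 c))
    count-C : ∀ {z} → IsLetter z → + N z Cc ≡ when (uC z) 1ℤ
    count-C {z} lz = Column.count-column g0 c z c≤2n lz
    count-D : ∀ {z} → IsLetter z → + N z Dc ≡ when (uD z) 1ℤ
    count-D {z} lz = Column.count-column gT c z c≤2n lz
    C-noComplements : ∀ {z} → IsLetter z → T (not (uC z ∧ uC (bar z)))
    C-noComplements {z} lz = T-not⁺ (Column.not-both-complements g0 c z c≤n lz)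
    D-noComplements : ∀ {z} → IsLetter z → T (not (uD z ∧ uD (bar z)))
    D-noComplements {z} lz = T-not⁺ (Column.not-both-complements gT c z c≤n lz)
    bb : ∀ {z} → IsLetter z → bar (bar z) ≡ z
    bb lz = bar-bar (letter≤2n+1 lz)
    classes-C≡D : ∀ {z} → IsLetter z → T (_⇔ᵇ_ (uD z ∨ uD (bar z)) (uC z ∨ uC (bar z)))
    classes-C≡D {z} lz = T-⇔ᵇ⁺ (inv z lz)

    l1 : IsLetter 1
    l1 = letter (s≤s z≤n) n≥1
    lb1 : IsLetter (bar 1)
    lb1 = bar-letter l1

    peak-end : ∀ l⁺ l⁻ → IsLetter l⁺ → bar l⁺ ≡ l⁻ → Pplus p ≡ l⁺ ∷ [] → Pminus p ≡ l⁻ ∷ [] →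
              (∀ τ → pair2 p τ ≡ + N l⁺ τ -ᶻ + N l⁻ τ) → T (ClassesDiffer p uC) → PeakProperty p Cc Dc
    peak-end l⁺ l⁻ l e P⁺ P⁻ pairing cnd = noOddPeak , evenPeak
      where
        u1 = uC l⁺
        u2 = uC l⁻
        v1 = uD l⁺
        v2 = uD l⁻
        M = mon cnd
        l⁻-letter : IsLetter l⁻
        l⁻-letter = subst IsLetter e (bar-letter l)
        hyp : T (splitColumnEnd u1 u2 v1 v2)
        hyp = T-∧⁺ (subst (λ t → T (not (u1 ∧ uC t))) e (C-noComplements l)) (T-∧⁺ (subst (λ t → T (not (v1 ∧ uD t))) e (D-noComplements l))
             (T-∧⁺ (subst (λ t → T ((v1 ∨ uD t) ⇔ᵇ (u1 ∨ uC t))) e (classes-C≡D l))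
             (T-∧⁺ (T-⇒ᵇ⁺ (proj₁ M l⁺ (subst (l⁺ ∈_) (sym P⁺) (here refl))))
                   (T-⇒ᵇ⁺ (proj₂ M l⁻ (subst (l⁻ ∈_) (sym P⁻) (here refl)))))))
        res = peakTableEnd u1 u2 v1 v2 hyp
        eC : pair2 p Cc ≡ pairingEnd u1 u2
        eC = trans (pairing Cc) (cong₂ _-ᶻ_ (count-C l) (count-C l⁻-letter))
        eD : pair2 p Dc ≡ pairingEnd v1 v2
        eD = trans (pairing Dc) (cong₂ _-ᶻ_ (count-D l) (count-D l⁻-letter))
        noOddPeak : pair2 p Cc ≡ + 1 → ¬ (pair2 p Dc ≤ᶻ 0ℤ)
        noOddPeak e' h = T-not-≤ᵇ⁻ (T-⇒ᵇ⁻ (proj₁ res) (isOne⁺ (trans (sym eC) e'))) (subst (_≤ᶻ 0ℤ) eD h)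
        evenPeak : pair2 p Dc ≡ + 1 → ¬ (pair2 p Cc +ᶻ 1ℤ ≤ᶻ 0ℤ) → PeakConclusion p Cc Dc
        evenPeak e' h = peakConclusion-single p Cc Dc l⁺ l⁻ P⁺ P⁻ (count-C l) (count-C l⁻-letter) (count-D l) (count-D l⁻-letter)
          (T-⇒ᵇ⁻ (proj₂ res) (T-∧⁺ (isOne⁺ (trans (sym eD) e')) (T-not-≤ᵇ⁺ (λ h' → h (subst (λ t → t +ᶻ 1ℤ ≤ᶻ 0ℤ) (sym eC) h')))))

    peak-p≡0 : p ≡ 0 → PeakProperty p Cc Dc
    peak-p≡0 refl = peak-end (bar 1) 1 lb1 (bb l1) refl refl (λ τ → flip (+ N 1 τ) (+ N (bar 1) τ)) _
      where
        flip : ∀ x y → -ᶻ (x -ᶻ y) ≡ y -ᶻ x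
        flip = solve-∀

    peak-p≡n : ∀ k → p ≡ suc k → suc k ≡ n → PeakProperty p Cc Dc
    peak-p≡n k refl e = peak-end n (bar n) (letter n≥1 ≤-refl) refl (Pplus-n k e) (Pminus-n k e) (λ τ → pair2-n k τ e)
      (subst T (sym (ClassesDiffer-n k uC e)) _)

    peak-mid : ∀ k → p ≡ suc k → suc k < n → PeakProperty p Cc Dc
    peak-mid k refl p<n = noOddPeak , evenPeak
      where
        ne : suc k ≢ n
        ne = <⇒≢ p<n
        pp = suc k
        q = suc pp
        lp : IsLetter pp
        lp = letter (s≤s z≤n) (<⇒≤ p<n)
        lq : IsLetter q
        lq = letter (s≤s z≤n) p<n
        lbp = bar-letter lp
        lbq = bar-letter lq
        u1 = uC pp
        u2 = uC (bar pp)
        u3 = uC q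
        u4 = uC (bar q)
        v1 = uD pp
        v2 = uD (bar pp)
        v3 = uD q
        v4 = uD (bar q)
        inP : ∀ {z} → z ∈ pp ∷ bar q ∷ [] → z ∈ Pplus pp
        inP {z} m = subst (z ∈_) (sym (Pplus-m k ne)) m
        inM : ∀ {z} → z ∈ q ∷ bar pp ∷ [] → z ∈ Pminus pp
        inM {z} m = subst (z ∈_) (sym (Pminus-m k ne)) m
        monT : T (((u1 ∨ u2) xor (u3 ∨ u4)) ⇒ᵇ ((u1 ⇒ᵇ v1) ∧ (u4 ⇒ᵇ v4) ∧ (v3 ⇒ᵇ u3) ∧ (v2 ⇒ᵇ u2)))
        monT = T-⇒ᵇ⁺ (λ cnd → let M = mon (subst T (sym (ClassesDiffer-mid pp uC (s≤s z≤n) p<n)) cnd) in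
                  T-∧⁺ (T-⇒ᵇ⁺ (proj₁ M pp (inP (here refl))))
                 (T-∧⁺ (T-⇒ᵇ⁺ (proj₁ M (bar q) (inP (there (here refl)))))
                 (T-∧⁺ (T-⇒ᵇ⁺ (proj₂ M q (inM (here refl))))
                     (T-⇒ᵇ⁺ (proj₂ M (bar pp) (inM (there (here refl))))))))
        hyp : T (splitColumnMid u1 u2 u3 u4 v1 v2 v3 v4)
        hyp = T-∧⁺ (C-noComplements lp) (T-∧⁺ (C-noComplements lq) (T-∧⁺ (D-noComplements lp) (T-∧⁺ (D-noComplements lq) (T-∧⁺ (classes-C≡D lp) (T-∧⁺ (classes-C≡D lq) monT)))))
        res = peakTableMid u1 u2 u3 u4 v1 v2 v3 v4 hyp
        eC : pair2 pp Cc ≡ pairingMid u1 u2 u3 u4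
        eC = trans (pair2-m k Cc ne) (cong₂ _-ᶻ_ (cong₂ _-ᶻ_ (count-C lp) (count-C lbp)) (cong₂ _-ᶻ_ (count-C lq) (count-C lbq)))
        eD : pair2 pp Dc ≡ pairingMid v1 v2 v3 v4
        eD = trans (pair2-m k Dc ne) (cong₂ _-ᶻ_ (cong₂ _-ᶻ_ (count-D lp) (count-D lbp)) (cong₂ _-ᶻ_ (count-D lq) (count-D lbq)))
        noOddPeak : pair2 pp Cc ≡ + 1 → ¬ (pair2 pp Dc ≤ᶻ 0ℤ)
        noOddPeak e' h = T-not-≤ᵇ⁻ (T-⇒ᵇ⁻ (proj₁ res) (isOne⁺ (trans (sym eC) e'))) (subst (_≤ᶻ 0ℤ) eD h)
        evenPeak : pair2 pp Dc ≡ + 1 → ¬ (pair2 pp Cc +ᶻ 1ℤ ≤ᶻ 0ℤ) → PeakConclusion pp Cc Dc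
        evenPeak e' h = peakConclusion-pair pp Cc Dc pp (bar pp) q (bar q) (Pplus-m k ne) (Pminus-m k ne)
          (count-C lp) (count-C lbp) (count-C lq) (count-C lbq) (count-D lp) (count-D lbp) (count-D lq) (count-D lbq)
          (T-⇒ᵇ⁻ (proj₂ res) (T-∧⁺ (isOne⁺ (trans (sym eD) e')) (T-not-≤ᵇ⁺ (λ h' → h (subst (λ t → t +ᶻ 1ℤ ≤ᶻ 0ℤ) (sym eC) h')))))

  blockPeakProperty : ∀ p c C D → 1 ≤ n → p ≤ n → c ≤ n → BlockInfo C D c → PeakProperty p C D
  blockPeakProperty p c C D n≥1 p≤n c≤n (w0 , g0 , Ts , refl , refl , path , roots) = disp p refl
    where
      module B = BlockPeak p c n≥1 p≤n c≤n g0 Ts roots path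
      disp : ∀ k → p ≡ k → PeakProperty p B.Cc B.Dc
      disp zero e = B.peak-p≡0 e
      disp (suc k) e with suc k ≟ n
      ... | yes e' = B.peak-p≡n k e e'
      ... | no ne = B.peak-mid k e (≤∧≢⇒< (subst (_≤ n) e p≤n) ne)

module SfillColumns (n : ℕ) (lam : List ℕ) (length≤n : length lam ≤ n)
                    (J : Subset (length (TypeC.Γ n lam))) (adm : TypeC.Admissible n lam J) (p : ℕ) (p≤n : p ≤ n) where
  open TypeC n
  open TypeCColumns n

  col≡cols : ∀ q → col lam J q ≡ colAt (cols (λ x → x) (conj lam) (toList J)) q
  col≡cols q = cong (λ t → colAt (colsGo (λ x → x) (blockSizes lam) (map selected t)) q) (chunks-zip (blocks lam) (toList J))

  conj≤n : ∀ c → c ∈ conj lam → c ≤ n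
  conj≤n c m with ∈-map⁻ (λ j → countGe j lam) m
  ... | j , _ , refl = ≤-trans (countGe≤length j lam) length≤n

  length-conj : length (conj lam) ≡ part₁ lam
  length-conj = trans (LP.length-map (λ j → countGe j lam) (asc 1 (part₁ lam)))
                  (trans (cong length (asc≡range 1 (part₁ lam))) (length-range 1 (part₁ lam)))

  1≤n : ∀ {i} → i < part₁ lam → 1 ≤ n
  1≤n {i} i<λ₁ = ≤-trans (nonempty lam i<λ₁) length≤n
    where
      nonempty : ∀ (l : List ℕ) → i < part₁ l → 1 ≤ length l
      nonempty (x ∷ l) _ = s≤s z≤n

  peakProperty : ∀ i → i < part₁ lam → PeakProperty p (col lam J (suc (2 * i))) (col lam J (suc (suc (2 * i))))
  peakProperty i i<λ₁ with blockStructure (conj lam) (toList J) (λ x → x) SignedPerm-id conj≤n adm i (subst (i <_) (sym length-conj) i<λ₁)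
  ... | c , c∈ , info = subst₂ (PeakProperty p) (sym (col≡cols (suc (2 * i)))) (sym (col≡cols (suc (suc (2 * i)))))
                          (blockPeakProperty p c _ _ (1≤n i<λ₁) p≤n (conj≤n c c∈) info)

  noPeakAtOdd : ∀ i → i < part₁ lam → a2 lam J p (suc (2 * i)) ≡ + 1 →
    ¬ (h2 lam J p (suc (suc (2 * i))) ℤ.≤ h2 lam J p (suc (2 * i)))
  noPeakAtOdd i i<λ₁ a≡1 h≤ = proj₁ (peakProperty i i<λ₁) a≡1 (x+y≤x⇒y≤0 _ _ h≤)

  peakAtEven : ∀ i → 2 * suc i ≤ 2 * part₁ lam → a2 lam J p (suc (suc (2 * i))) ≡ + 1 →
    h2 lam J p (2 * i) ℤ.< h2 lam J p (suc (suc (2 * i))) →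
    PeakConclusion p (col lam J (2 * suc i ∸ 1)) (col lam J (2 * suc i))
  peakAtEven i bound a≡1 h< = subst₂ (PeakConclusion p) (cong (λ t → col lam J (t ∸ 1)) (sym 2+2i≡)) (cong (col lam J) (sym 2+2i≡))
                                (proj₂ (peakProperty i (*-cancelˡ-≤ 2 bound)) a≡1 noDrop)
    where
      2+2i≡ = 2*[1+i]≡2+2*i i
      h₀ = h2 lam J p (2 * i)
      a₁ = pair2 p (col lam J (suc (2 * i)))
      noDrop : ¬ (a₁ +ᶻ 1ℤ ≤ᶻ 0ℤ)
      noDrop a₁+1≤0 = ZP.<⇒≱ h< (begin
          h₀ +ᶻ a₁ +ᶻ pair2 p (col lam J (suc (suc (2 * i)))) ≡⟨ ZP.+-assoc h₀ a₁ _ ⟩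
          h₀ +ᶻ (a₁ +ᶻ a2 lam J p (suc (suc (2 * i))))        ≡⟨ cong (λ z → h₀ +ᶻ (a₁ +ᶻ z)) a≡1 ⟩
          h₀ +ᶻ (a₁ +ᶻ 1ℤ)                                    ≤⟨ ZP.+-monoʳ-≤ h₀ a₁+1≤0 ⟩
          h₀ +ᶻ 0ℤ                                            ≡⟨ ZP.+-identityʳ h₀ ⟩
          h₀ ∎)
        where open ZP.≤-Reasoning

proposition4p25 : (n : ℕ) (lam : List ℕ) → Linked _≥_ lam → length lam ≤ n →
    (J : Subset (length (TypeC.Γ n lam))) → TypeC.Admissible n lam J →
    (p : ℕ) → p ≤ n →
    (m' : ℕ) → m' ≤ 2 * part₁ lam →
    (∀ t → t ≤ 2 * part₁ lam → TypeC.h2 n lam J p t ℤ.≤ TypeC.h2 n lam J p m') →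
    (∀ t → t < m' → TypeC.h2 n lam J p t ℤ.< TypeC.h2 n lam J p m') →
    TypeC.a2 n lam J p m' ≡ + 1 →
    ∃ λ i → 1 ≤ i × i ≤ part₁ lam × m' ≡ 2 * i ×
      ∃ λ x → x ∈ TypeC.Pplus n p
        × x ∈ TypeC.col n lam J (2 * i Data.Nat.∸ 1) × x ∈ TypeC.col n lam J (2 * i)
        × (∀ y → y ∈ TypeC.Pplus n p → y ∈ TypeC.col n lam J (2 * i Data.Nat.∸ 1) → y ≡ x)
        × (∀ y → y ∈ TypeC.Pplus n p → y ∈ TypeC.col n lam J (2 * i) → y ≡ x)
        × (∀ y → y ∈ TypeC.Pminus n p → y ∉ TypeC.col n lam J (2 * i Data.Nat.∸ 1))
        × (∀ y → y ∈ TypeC.Pminus n p → y ∉ TypeC.col n lam J (2 * i))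
-- The argument never uses that λ is weakly decreasing.
proposition4p25 n lam _ length≤n J adm p p≤n zero _ _ _ ()
proposition4p25 n lam _ length≤n J adm p p≤n (suc j) m'≤ h≤hm' h<hm' a≡1 with even⊎odd j
... | inj₁ (i , refl) =
  ⊥-elim (noPeakAtOdd i i<λ₁ a≡1 (h≤hm' (suc (suc (2 * i))) (subst (_≤ 2 * part₁ lam) (2*[1+i]≡2+2*i i) (*-monoʳ-≤ 2 i<λ₁))))
  where
    open SfillColumns n lam length≤n J adm p p≤n
    i<λ₁ : i < part₁ lam
    i<λ₁ = ≰⇒> (λ h → <⇒≱ m'≤ (*-monoʳ-≤ 2 h))
... | inj₂ (i , refl) = suc i , s≤s z≤n , *-cancelˡ-≤ 2 bound , sym (2*[1+i]≡2+2*i i) ,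
                        peakAtEven i bound a≡1 (h<hm' (2 * i) (n≤1+n (suc (2 * i))))
  where
    open SfillColumns n lam length≤n J adm p p≤n
    bound : 2 * suc i ≤ 2 * part₁ lam
    bound = subst (_≤ 2 * part₁ lam) (sym (2*[1+i]≡2+2*i i)) m'≤
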